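{- Let $d\ge3$, $\mathcal A$, $\varphi$, $\mathbf u$, $F_k$, $f$ and $T_0,\dots,T_{d-1}$ be as in the context. Fix $k\in\{0,1,\dots,d-1\}$ and let $w$ be the bispecial factor associated with $f^k(T_{d-1-k})$. If $k=d-1$, then $w=(d-1)F_{d-1}(d-1)$, $w$ has exactly two left and exactly two right extensions, $B:=w\varphi^{d-1}(0)$ is a complete return word to $w$ in $\mathbf u$, and $\vec R\ge\vec B$ for every complete return word $R$ to $w$ in $\mathbf u$. If $k<d-1$, then $w=F_k(d-1)$, $w$ has exactly two left and exactly two right extensions, $A:=\varphi^k(d-1)w$ and $B:=w\varphi^{d-1}(0)$ are complete return words to $w$ in $\mathbf u$, and for every complete return word $R$ to $w$ in $\mathbf u$ we have $\vec R\ge\vec A$ or $\vec R\ge\vec B$.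
   Context: $\mathcal A=\{0,\dots,d-1\}$; $\varphi(i)=0(i+1)$ for $0\le i\le d-2$, $\varphi(d-1)=0(d-1)(d-1)$; $\mathbf u=u_0u_1\cdots$ is the fixed point of $\varphi$ starting with $0$, $\mathcal L(\mathbf u)$ its set of finite factors. $F_0=\varepsilon$, $F_k=\varphi(F_{k-1})0$ ($1\le k\le d-1$). $\vec v=(|v|_0,\dots,|v|_{d-1})^T$ is the Parikh vector of $v$, and $\vec x\ge\vec y$ means componentwise inequality. If $j<\ell$ are consecutive occurrences of $w$ in $\mathbf u$, then $u_j\cdots u_{\ell+|w|-1}$ is a complete return word to $w$. A factor $w$ is bispecial if it has at least two left extensions ($a$ with $aw\in\mathcal L(\mathbf u)$) and at least two right extensions. Let $\mathcal T=\{(a,w,b): w\text{ bispecial factor of }\mathbf u,\ a,b\in\mathcal A,\ a,b<d-1,\ aw,wb\in\mathcal L(\mathbf u)\}$; $w$ is the bispecial factor associated with $(a,w,b)$. For $(a,w,b)\in\mathcal T$ define $f(a,w,b)=(a',w',b')$ with $a'=(a+1)\bmod (d-1)$, $b'=(b+1)\bmod(d-1)$ (residues in $\{0,\dots,d-2\}$) and $w'=\varphi(w)0$ if $a<d-2,b<d-2$; $w'=\varphi(w)0(d-1)$ if $a<d-2,b=d-2$; $w'=(d-1)\varphi(w)0$ if $a=d-2,b<d-2$; $w'=(d-1)\varphi(w)0(d-1)$ if $a=b=d-2$. For $k=0,\dots,d-2$ let $T_k=(0,\varepsilon,k)$, and $T_{d-1}=(0,d-1,0)$. -}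

module Defs where

open import Data.Nat using (ℕ; zero; suc; _+_; _∸_; _≤_; _<_; _<?_; _≟_)
open import Data.Nat.DivMod using (_%_)
open import Data.List using (List; []; _∷_; _++_; length; map; upTo; concatMap; filter)
open import Data.Fin using (Fin; toℕ)
open import Data.Product using (Σ; ∃; _×_; _,_; proj₁; proj₂)
open import Data.Sum using (_⊎_)
open import Relation.Binary.PropositionalEquality using (_≡_; _≢_)
open import Relation.Nullary using (¬_; yes; no)
open import Function using (_∘_)

-- Letters of the alphabet 𝒜 = {0,…,d-1} are represented by natural numbers
-- (< d); words are lists of letters.
Word : Set
Word = List ℕ

φ₁ : ℕ → ℕ → Word
φ₁ d i with suc i <? d
... | yes _ = 0 ∷ suc i ∷ []
... | no  _ = 0 ∷ (d ∸ 1) ∷ (d ∸ 1) ∷ []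

φ : ℕ → Word → Word
φ d = concatMap (φ₁ d)

φ^ : ℕ → ℕ → Word → Word
φ^ d zero    v = v
φ^ d (suc n) v = φ d (φ^ d n v)

-- n-th letter of a word (default 0 if out of range; never used out of range below)
at : Word → ℕ → ℕ
at []      _       = 0
at (x ∷ v) zero    = x
at (x ∷ v) (suc n) = at v n

-- the fixed point u = lim φⁿ(0): u_n is the n-th letter of φ^{n+1}(0)
-- (|φ^{n+1}(0)| > n and φ^m(0) is a prefix of φ^{m+1}(0))
u : ℕ → ℕ → ℕ
u d n = at (φ^ d (suc n) (0 ∷ [])) n

slice : ℕ → ℕ → ℕ → Word
slice d i n = map (λ j → u d (i + j)) (upTo n)

OccursAt : ℕ → Word → ℕ → Set
OccursAt d w i = slice d i (length w) ≡ w

InLang : ℕ → Word → Set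
InLang d w = ∃ λ i → OccursAt d w i

IsCompleteReturnWord : ℕ → Word → Word → Set
IsCompleteReturnWord d w R =
  Σ ℕ λ j → Σ ℕ λ ℓ →
    j < ℓ × OccursAt d w j × OccursAt d w ℓ ×
    (∀ m → j < m → m < ℓ → ¬ OccursAt d w m) ×
    R ≡ slice d j ((ℓ + length w) ∸ j)

ExactlyTwoLeft : ℕ → Word → Set
ExactlyTwoLeft d w =
  Σ ℕ λ a → Σ ℕ λ b → a < d × b < d × a ≢ b ×
    InLang d (a ∷ w) × InLang d (b ∷ w) ×
    (∀ c → c < d → InLang d (c ∷ w) → c ≡ a ⊎ c ≡ b)

ExactlyTwoRight : ℕ → Word → Set
ExactlyTwoRight d w =
  Σ ℕ λ a → Σ ℕ λ b → a < d × b < d × a ≢ b ×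
    InLang d (w ++ a ∷ []) × InLang d (w ++ b ∷ []) ×
    (∀ c → c < d → InLang d (w ++ c ∷ []) → c ≡ a ⊎ c ≡ b)

count : ℕ → Word → ℕ
count a v = length (filter (_≟ a) v)

parikh : (d : ℕ) → Word → Fin d → ℕ
parikh d v i = count (toℕ i) v

_≥P_ : {d : ℕ} → (Fin d → ℕ) → (Fin d → ℕ) → Set
x ≥P y = ∀ i → y i ≤ x i

F : ℕ → ℕ → Word
F d zero    = []
F d (suc k) = φ d (F d k) ++ 0 ∷ []

incMod : ℕ → ℕ → ℕ
incMod zero    a = 0
incMod (suc e) a = suc a % suc e

Triple : Set
Triple = ℕ × Word × ℕ

-- the map f on triples (a,w,b); letters a,b ∈ {0,…,d-2}, so "a < d-2" ⇔ "a ≠ d-2"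
f : ℕ → Triple → Triple
f d (a , w , b) = incMod (d ∸ 1) a , pre ++ φ d w ++ 0 ∷ [] ++ post , incMod (d ∸ 1) b
  where
    pre : Word
    pre with a ≟ d ∸ 2
    ... | yes _ = (d ∸ 1) ∷ []
    ... | no  _ = []
    post : Word
    post with b ≟ d ∸ 2
    ... | yes _ = (d ∸ 1) ∷ []
    ... | no  _ = []

f^ : ℕ → ℕ → Triple → Triple
f^ d zero    t = t
f^ d (suc n) t = f d (f^ d n t)

T : ℕ → ℕ → Triple
T d k with k ≟ d ∸ 1
... | yes _ = 0 , (d ∸ 1) ∷ [] , 0
... | no  _ = 0 , [] , k

bisp : Triple → Word
bisp t = proj₁ (proj₂ t)

-- Since u = φ(u), every position of u lies in a block φ(u_m) starting at pos m, and the block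
-- boundaries can be recovered locally (zeros start blocks, a letter c with 0 < c < d-1 is the
-- second letter of φ(c-1), d-1 is followed by 0 or d-1). Desubstituting repeatedly shows that
-- F_k c with c ≥ k occurs only at the start pos^ k m of a block φ^k(u_m).
--
-- For k < d-1 put τ = d-1-k. Then w = F_k (d-1) occurs exactly at the positions pos^ k m with
-- u_m ≥ τ (call such m marked), so a complete return word is φ^k(u_m ⋯ u_{m'-1}) w for
-- consecutive marked m < m'. If u_m = d-1 it contains A = φ^k(d-1) w. Otherwise u_m is followed
-- by F_τ, whose letters are all < τ, so the return word contains φ^k(u_m) φ^k(F_τ) w, where
-- φ^k(u_m) begins with w; hence its Parikh vector dominates that of w φ^k(F_τ) w = B.
--
-- For k = d-1 every block φ^{d-1}(u_m) starts with W₀ = φ^{d-1}(0) and ends with d-1, so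
-- w = (d-1) W₀ occurs exactly in front of each block φ^{d-1}(u_m), m ≥ 1, and every complete
-- return word contains w W₀ = B.
--
-- In both cases the left extensions are σ^k(u_m) with u_m ∈ {0, d-1} (the letters that can
-- precede a nonzero letter), and the right extensions are the letters 0, d-1 that can follow d-1.

module Submission where

open import Defs
open import Data.Nat using (ℕ; zero; suc; _+_; _∸_; _≤_; _<_; _≤′_; ≤′-refl; ≤′-step; _<?_; _≤?_; _≟_; z≤n; s≤s)
open import Data.Nat.Properties
open import Data.Nat.DivMod using (m<n⇒m%n≡m)
open import Data.List using ([]; _∷_; _++_; length; filter; applyUpTo)
open import Data.List.Properties
  using (++-assoc; ++-identityʳ; length-++; concatMap-++; filter-++; map-applyUpTo; ∷-injective)
open import Data.List.Relation.Unary.All using (All; []; _∷_)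
import Data.List.Relation.Unary.All as All
import Data.List.Relation.Unary.All.Properties as All
open import Data.Product using (Σ; _×_; _,_; proj₁; proj₂; map₁; map₂)
open import Data.Sum using (_⊎_; inj₁; inj₂; map)
open import Data.Empty using (⊥-elim)
open import Data.Fin using (toℕ)
open import Relation.Binary.PropositionalEquality
open import Relation.Binary.Bundles using (Preorder)
open import Relation.Binary.Structures using (IsPreorder)
open import Relation.Nullary using (¬_; yes; no)
open import Function using (_∘_)

++-injective : (a b c e : Word) → length a ≡ length c → a ++ b ≡ c ++ e → a ≡ c × b ≡ e
++-injective []      b []      e _ eq = refl , eq
++-injective (x ∷ a) b (y ∷ c) e l eq with ∷-injective eq
... | refl , eq′ = map₁ (cong (x ∷_)) (++-injective a b c e (suc-injective l) eq′)

at-++ˡ : (a b : Word) → ∀ r → r < length a → at (a ++ b) r ≡ at a r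
at-++ˡ (x ∷ a) b zero    _         = refl
at-++ˡ (x ∷ a) b (suc r) (s≤s r<a) = at-++ˡ a b r r<a

All-at : ∀ {P : ℕ → Set} {v : Word} r → All P v → r < length v → P (at v r)
All-at zero    (p ∷ _)  _         = p
All-at (suc r) (_ ∷ ps) (s≤s r<v) = All-at r ps r<v

φ-++ : ∀ d (a b : Word) → φ d (a ++ b) ≡ φ d a ++ φ d b
φ-++ d = concatMap-++ (φ₁ d)

φ^-++ : ∀ d n (a b : Word) → φ^ d n (a ++ b) ≡ φ^ d n a ++ φ^ d n b
φ^-++ d zero    a b = refl
φ^-++ d (suc n) a b = trans (cong (φ d) (φ^-++ d n a b)) (φ-++ d (φ^ d n a) (φ^ d n b))

φ^-∷ : ∀ d n x (v : Word) → φ^ d n (x ∷ v) ≡ φ^ d n (x ∷ []) ++ φ^ d n v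
φ^-∷ d n x v = φ^-++ d n (x ∷ []) v

φ^-sucʳ : ∀ d n (v : Word) → φ^ d (suc n) v ≡ φ^ d n (φ d v)
φ^-sucʳ d zero    v = refl
φ^-sucʳ d (suc n) v = cong (φ d) (φ^-sucʳ d n v)

φ^-+ : ∀ d m n (v : Word) → φ^ d (m + n) v ≡ φ^ d m (φ^ d n v)
φ^-+ d zero    n v = refl
φ^-+ d (suc m) n v = cong (φ d) (φ^-+ d m n v)

data φ₁-View (d x : ℕ) : Set where
  short : suc x < d → φ₁ d x ≡ 0 ∷ suc x ∷ [] → φ₁-View d x
  long  : ¬ suc x < d → φ₁ d x ≡ 0 ∷ (d ∸ 1) ∷ (d ∸ 1) ∷ [] → φ₁-View d x

φ₁-short : ∀ d x → suc x < d → φ₁ d x ≡ 0 ∷ suc x ∷ []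
φ₁-short d x p with suc x <? d
... | yes _ = refl
... | no ¬p = ⊥-elim (¬p p)

φ₁-long : ∀ d x → ¬ suc x < d → φ₁ d x ≡ 0 ∷ (d ∸ 1) ∷ (d ∸ 1) ∷ []
φ₁-long d x ¬p with suc x <? d
... | yes p = ⊥-elim (¬p p)
... | no _  = refl

φ₁-view : ∀ d x → φ₁-View d x
φ₁-view d x with suc x <? d
... | yes p = short p (φ₁-short d x p)
... | no ¬p = long ¬p (φ₁-long d x ¬p)

2≤length-φ₁ : ∀ d x → 2 ≤ length (φ₁ d x)
2≤length-φ₁ d x with φ₁-view d x
... | short _ eq rewrite eq = s≤s (s≤s z≤n)
... | long  _ eq rewrite eq = s≤s (s≤s z≤n)

length-φ-≥ : ∀ d (v : Word) → length v ≤ length (φ d v)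
length-φ-≥ d []      = z≤n
length-φ-≥ d (x ∷ v) rewrite length-++ (φ₁ d x) {φ d v} =
  +-mono-≤ (≤-trans (s≤s z≤n) (2≤length-φ₁ d x)) (length-φ-≥ d v)

length-φ^-≥ : ∀ d n (v : Word) → length v ≤ length (φ^ d n v)
length-φ^-≥ d zero    v = ≤-refl
length-φ^-≥ d (suc n) v = ≤-trans (length-φ^-≥ d n v) (length-φ-≥ d (φ^ d n v))

count-++ : ∀ a (v w : Word) → count a (v ++ w) ≡ count a v + count a w
count-++ a v w = trans (cong length (filter-++ (_≟ a) v w)) (length-++ (filter (_≟ a) v))

infix 4 _≼_
record _≼_ (v w : Word) : Set where
  constructor dominated
  field count-≤ : ∀ a → count a v ≤ count a w
open _≼_

≼-isPreorder : IsPreorder _≡_ _≼_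
≼-isPreorder = record
  { isEquivalence = isEquivalence
  ; reflexive     = λ { refl → dominated λ a → ≤-refl }
  ; trans         = λ p q → dominated λ a → ≤-trans (count-≤ p a) (count-≤ q a)
  }

≼-preorder : Preorder _ _ _
≼-preorder = record { isPreorder = ≼-isPreorder }

≼-refl : ∀ {v} → v ≼ v
≼-refl = IsPreorder.refl ≼-isPreorder

++-mono-≼ : ∀ {v v′ w w′ : Word} → v ≼ v′ → w ≼ w′ → v ++ w ≼ v′ ++ w′
++-mono-≼ {v} {v′} {w} {w′} p q = dominated λ a →
  subst₂ _≤_ (sym (count-++ a v w)) (sym (count-++ a v′ w′)) (+-mono-≤ (count-≤ p a) (count-≤ q a))

v≼v++w : ∀ v w → v ≼ v ++ w
v≼v++w v w = dominated λ a → subst (count a v ≤_) (sym (count-++ a v w)) (m≤m+n _ _)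

w≼v++w : ∀ v w → w ≼ v ++ w
w≼v++w v w = dominated λ a → subst (count a w ≤_) (sym (count-++ a v w)) (m≤n+m _ _)

≼⇒≥P : ∀ {d v w} → v ≼ w → parikh d w ≥P parikh d v
≼⇒≥P v≼w i = count-≤ v≼w (toℕ i)

LongCaseClaims : ℕ → Word → Set
LongCaseClaims d w =
  w ≡ (d ∸ 1) ∷ F d (d ∸ 1) ++ (d ∸ 1) ∷ []
  × ExactlyTwoLeft d w
  × ExactlyTwoRight d w
  × IsCompleteReturnWord d w (w ++ φ^ d (d ∸ 1) (0 ∷ []))
  × (∀ R → IsCompleteReturnWord d w R → parikh d R ≥P parikh d (w ++ φ^ d (d ∸ 1) (0 ∷ [])))

ShortCaseClaims : ℕ → ℕ → Word → Set
ShortCaseClaims d k w =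
  w ≡ F d k ++ (d ∸ 1) ∷ []
  × ExactlyTwoLeft d w
  × ExactlyTwoRight d w
  × IsCompleteReturnWord d w (φ^ d k ((d ∸ 1) ∷ []) ++ w)
  × IsCompleteReturnWord d w (w ++ φ^ d (d ∸ 1) (0 ∷ []))
  × (∀ R → IsCompleteReturnWord d w R →
       parikh d R ≥P parikh d (φ^ d k ((d ∸ 1) ∷ []) ++ w) ⊎ parikh d R ≥P parikh d (w ++ φ^ d (d ∸ 1) (0 ∷ [])))

module FixedPoint (e : ℕ) where

  d E : ℕ
  d = 3 + e
  E = 2 + e

  E<d : E < d
  E<d = ≤-refl

  -- An opaque copy of u d, so that the type checker never unfolds the fixed point.
  opaque
    𝐮 : ℕ → ℕ
    𝐮 = u d

  opaque
    unfolding 𝐮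
    𝐮≡u : ∀ n → 𝐮 n ≡ u d n
    𝐮≡u n = refl

  factor : ℕ → ℕ → Word
  factor i zero    = []
  factor i (suc n) = 𝐮 i ∷ factor (suc i) n

  length-factor : ∀ i n → length (factor i n) ≡ n
  length-factor i zero    = refl
  length-factor i (suc n) = cong suc (length-factor (suc i) n)

  factor-+ : ∀ i a b → factor i (a + b) ≡ factor i a ++ factor (i + a) b
  factor-+ i zero    b = cong (λ j → factor j b) (sym (+-identityʳ i))
  factor-+ i (suc a) b =
    cong (𝐮 i ∷_) (trans (factor-+ (suc i) a b) (cong (λ j → factor (suc i) a ++ factor j b) (sym (+-suc i a))))

  at-factor : ∀ i n r → r < n → at (factor i n) r ≡ 𝐮 (i + r)
  at-factor i (suc n) zero    _         = cong 𝐮 (sym (+-identityʳ i))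
  at-factor i (suc n) (suc r) (s≤s r<n) = trans (at-factor (suc i) n r r<n) (cong 𝐮 (sym (+-suc i r)))

  slice≡factor : ∀ i n → slice d i n ≡ factor i n
  slice≡factor i n = trans (map-applyUpTo (λ j → j) (λ j → u d (i + j)) n) (go i n λ j → sym (𝐮≡u (i + j)))
    where
    go : ∀ i n {g : ℕ → ℕ} → (∀ j → g j ≡ 𝐮 (i + j)) → applyUpTo g n ≡ factor i n
    go i zero    g≗ = refl
    go i (suc n) g≗ = cong₂ _∷_ (trans (g≗ 0) (cong 𝐮 (+-identityʳ i)))
                                (go (suc i) n λ j → trans (g≗ (suc j)) (cong 𝐮 (+-suc i j)))

  Occ : ℕ → Word → Set
  Occ i v = factor i (length v) ≡ v

  Occ⇒OccursAt : ∀ {i v} → Occ i v → OccursAt d v i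
  Occ⇒OccursAt {i} {v} = trans (slice≡factor i (length v))

  OccursAt⇒Occ : ∀ {i v} → OccursAt d v i → Occ i v
  OccursAt⇒Occ {i} {v} = trans (sym (slice≡factor i (length v)))

  Occ-factor : ∀ i n → Occ i (factor i n)
  Occ-factor i n = cong (factor i) (length-factor i n)

  Occ-at : ∀ {i v} r → Occ i v → r < length v → 𝐮 (i + r) ≡ at v r
  Occ-at {i} {v} r o r<v = trans (sym (at-factor i (length v) r r<v)) (cong (λ w → at w r) o)

  Occ-from-letters : ∀ i v → (∀ r → r < length v → 𝐮 (i + r) ≡ at v r) → Occ i v
  Occ-from-letters i []      _  = refl
  Occ-from-letters i (x ∷ v) eq =
    cong₂ _∷_ (trans (cong 𝐮 (sym (+-identityʳ i))) (eq 0 (s≤s z≤n)))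
              (Occ-from-letters (suc i) v λ r r<v → trans (cong 𝐮 (sym (+-suc i r))) (eq (suc r) (s≤s r<v)))

  Occ-++ : ∀ {i} a b → Occ i a → Occ (i + length a) b → Occ i (a ++ b)
  Occ-++ {i} a b oa ob =
    trans (cong (factor i) (length-++ a)) (trans (factor-+ i (length a) (length b)) (cong₂ _++_ oa ob))

  Occ-++⁻ : ∀ {i} a b → Occ i (a ++ b) → Occ i a × Occ (i + length a) b
  Occ-++⁻ {i} a b o = ++-injective _ _ a b (length-factor i (length a))
    (trans (sym (factor-+ i (length a) (length b))) (trans (cong (factor i) (sym (length-++ a))) o))

  Occ-++⁻ˡ : ∀ {i} a b → Occ i (a ++ b) → Occ i a
  Occ-++⁻ˡ a b = proj₁ ∘ Occ-++⁻ a b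

  Occ-++⁻ʳ : ∀ {i} a b → Occ i (a ++ b) → Occ (i + length a) b
  Occ-++⁻ʳ a b = proj₂ ∘ Occ-++⁻ a b

  Occ-head : ∀ {i x v} → Occ i (x ∷ v) → 𝐮 i ≡ x
  Occ-head o = proj₁ (∷-injective o)

  Occ-tail : ∀ {i x v} → Occ i (x ∷ v) → Occ (suc i) v
  Occ-tail o = proj₂ (∷-injective o)

  Occ-letter : ∀ {i} a x r → Occ i (a ++ x ∷ r) → 𝐮 (i + length a) ≡ x
  Occ-letter a x r o = Occ-head (Occ-++⁻ʳ a (x ∷ r) o)

  Occ-prefix : ∀ {i v} n → Occ i v → n ≤ length v → Σ Word λ t → v ≡ factor i n ++ t
  Occ-prefix {i} {v} n o n≤v = factor (i + n) (length v ∸ n) ,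
    trans (sym o) (trans (cong (factor i) (sym (m+[n∸m]≡n n≤v))) (factor-+ i n (length v ∸ n)))

  Φ : ℕ → Word
  Φ N = φ^ d N (0 ∷ [])

  φ₁-0 : φ₁ d 0 ≡ 0 ∷ 1 ∷ []
  φ₁-0 = φ₁-short d 0 (s≤s (s≤s z≤n))

  Φ-suc : ∀ N → Φ (suc N) ≡ Φ N ++ φ^ d N (1 ∷ [])
  Φ-suc N = trans (φ^-sucʳ d N (0 ∷ []))
    (trans (cong (φ^ d N) (trans (++-identityʳ (φ₁ d 0)) φ₁-0)) (φ^-∷ d N 0 (1 ∷ [])))

  Φ-prefix : ∀ j N → Σ Word λ t → Φ (j + N) ≡ Φ N ++ t
  Φ-prefix zero    N = [] , sym (++-identityʳ (Φ N))
  Φ-prefix (suc j) N with Φ-prefix j N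
  ... | t , eq = t ++ φ^ d (j + N) (1 ∷ []) ,
    trans (Φ-suc (j + N)) (trans (cong (_++ φ^ d (j + N) (1 ∷ [])) eq) (++-assoc (Φ N) t _))

  N<length-Φ : ∀ N → N < length (Φ N)
  N<length-Φ zero    = s≤s z≤n
  N<length-Φ (suc N) rewrite Φ-suc N | length-++ (Φ N) {φ^ d N (1 ∷ [])} =
    subst (_≤ length (Φ N) + length (φ^ d N (1 ∷ []))) (+-comm (suc N) 1)
      (+-mono-≤ (N<length-Φ N) (length-φ^-≥ d N (1 ∷ [])))

  𝐮-Φ : ∀ N n → n < length (Φ N) → 𝐮 n ≡ at (Φ N) n
  𝐮-Φ N n n<Φ with Φ-prefix N (suc n) | Φ-prefix (suc n) N
  ... | t₁ , eq₁ | t₂ , eq₂ = begin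
    𝐮 n                          ≡⟨ 𝐮≡u n ⟩
    at (Φ (suc n)) n             ≡⟨ at-++ˡ (Φ (suc n)) t₁ n (<-trans (n<1+n n) (N<length-Φ (suc n))) ⟨
    at (Φ (suc n) ++ t₁) n       ≡⟨ cong (λ w → at w n) eq₁ ⟨
    at (Φ (N + suc n)) n         ≡⟨ cong (λ j → at (Φ j) n) (+-comm N (suc n)) ⟩
    at (Φ (suc n + N)) n         ≡⟨ cong (λ w → at w n) eq₂ ⟩
    at (Φ N ++ t₂) n             ≡⟨ at-++ˡ (Φ N) t₂ n n<Φ ⟩
    at (Φ N) n                   ∎
    where open ≡-Reasoning

  Φ-head : ∀ N → Σ Word λ t → Φ N ≡ 0 ∷ t
  Φ-head zero    = [] , refl
  Φ-head (suc N) with Φ-head N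
  ... | t , eq = 1 ∷ φ d t , trans (cong (φ d) eq) (cong (_++ φ d t) φ₁-0)

  Occ-Φ : ∀ N → Occ 0 (Φ N)
  Occ-Φ N = Occ-from-letters 0 (Φ N) (𝐮-Φ N)

  Occ-φ-prefix : ∀ n → Occ 0 (φ d (factor 0 n))
  Occ-φ-prefix n with Occ-prefix n (Occ-Φ (suc n)) (<⇒≤ (<-trans (n<1+n n) (N<length-Φ (suc n))))
  ... | t , eq = Occ-++⁻ˡ (φ d (factor 0 n)) (φ d t)
    (subst (Occ 0) (trans (cong (φ d) eq) (φ-++ d (factor 0 n) t)) (Occ-Φ (suc (suc n))))

  -- Since u = φ(u), the block φ(u_m) starts at position pos m of u.
  opaque
    pos : ℕ → ℕ
    pos m = length (φ d (factor 0 m))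

    pos-0 : pos 0 ≡ 0
    pos-0 = refl

    private
      φ-factor-+ : ∀ {m v} → Occ m v → φ d (factor 0 (m + length v)) ≡ φ d (factor 0 m) ++ φ d v
      φ-factor-+ {m} {v} o =
        trans (cong (φ d) (trans (factor-+ 0 m (length v)) (cong (factor 0 m ++_) o))) (φ-++ d (factor 0 m) v)

    pos-+ : ∀ {m v} → Occ m v → pos (m + length v) ≡ pos m + length (φ d v)
    pos-+ {m} o = trans (cong length (φ-factor-+ o)) (length-++ (φ d (factor 0 m)))

    Occ-φ : ∀ {m v} → Occ m v → Occ (pos m) (φ d v)
    Occ-φ {m} {v} o = Occ-++⁻ʳ (φ d (factor 0 m)) (φ d v)
      (subst (Occ 0) (φ-factor-+ o) (Occ-φ-prefix (m + length v)))

  pos^ : ℕ → ℕ → ℕ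
  pos^ zero    m = m
  pos^ (suc k) m = pos (pos^ k m)

  Occ-φ^ : ∀ k {m v} → Occ m v → Occ (pos^ k m) (φ^ d k v)
  Occ-φ^ zero    o = o
  Occ-φ^ (suc k) o = Occ-φ (Occ-φ^ k o)

  pos^-+ : ∀ k {m v} → Occ m v → pos^ k (m + length v) ≡ pos^ k m + length (φ^ d k v)
  pos^-+ zero    o = refl
  pos^-+ (suc k) o = trans (cong pos (pos^-+ k o)) (pos-+ (Occ-φ^ k o))

  Occ-φ^-𝐮 : ∀ k m → Occ (pos^ k m) (φ^ d k (𝐮 m ∷ []))
  Occ-φ^-𝐮 k m = Occ-φ^ k refl

  pos^-suc : ∀ k m → pos^ k (suc m) ≡ pos^ k m + length (φ^ d k (𝐮 m ∷ []))
  pos^-suc k m = trans (cong (pos^ k) (+-comm 1 m)) (pos^-+ k {m} {𝐮 m ∷ []} refl)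

  Occ-block : ∀ m {w} → φ₁ d (𝐮 m) ≡ w → Occ (pos m) w
  Occ-block m eq = subst (Occ (pos m)) (trans (++-identityʳ _) eq) (Occ-φ^-𝐮 1 m)

  pos-suc : ∀ m {w} → φ₁ d (𝐮 m) ≡ w → pos (suc m) ≡ pos m + length w
  pos-suc m eq = trans (pos^-suc 1 m) (cong (λ w → pos m + length w) (trans (++-identityʳ _) eq))

  pos^-0 : ∀ k → pos^ k 0 ≡ 0
  pos^-0 zero    = refl
  pos^-0 (suc k) = trans (cong pos (pos^-0 k)) pos-0

  pos^-<-suc : ∀ k m → pos^ k m < pos^ k (suc m)
  pos^-<-suc k m = subst (pos^ k m <_) (sym (pos^-suc k m))
    (subst (_≤ pos^ k m + length (φ^ d k (𝐮 m ∷ []))) (+-comm (pos^ k m) 1)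
      (+-monoʳ-≤ (pos^ k m) (length-φ^-≥ d k (𝐮 m ∷ []))))

  pos^-mono-≤ : ∀ k {m n} → m ≤ n → pos^ k m ≤ pos^ k n
  pos^-mono-≤ k = go ∘ ≤⇒≤′
    where
    go : ∀ {m n} → m ≤′ n → pos^ k m ≤ pos^ k n
    go ≤′-refl      = ≤-refl
    go (≤′-step m≤n) = ≤-trans (go m≤n) (<⇒≤ (pos^-<-suc k _))

  pos^-mono-< : ∀ k {m n} → m < n → pos^ k m < pos^ k n
  pos^-mono-< k {m} m<n = <-≤-trans (pos^-<-suc k m) (pos^-mono-≤ k m<n)

  pos^-cancel-< : ∀ k {m n} → pos^ k m < pos^ k n → m < n
  pos^-cancel-< k {m} {n} lt with m <? n
  ... | yes m<n = m<n
  ... | no  m≮n = ⊥-elim (<⇒≱ lt (pos^-mono-≤ k (≮⇒≥ m≮n)))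

  𝐮-pos : ∀ m → 𝐮 (pos m) ≡ 0
  𝐮-pos m with φ₁-view d (𝐮 m)
  ... | short _ eq = Occ-head (Occ-block m eq)
  ... | long  _ eq = Occ-head (Occ-block m eq)

  𝐮-pos+1-short : ∀ m → suc (𝐮 m) < d → 𝐮 (pos m + 1) ≡ suc (𝐮 m)
  𝐮-pos+1-short m p = Occ-letter (0 ∷ []) _ [] (Occ-block m (φ₁-short d (𝐮 m) p))

  𝐮-pos+1-long : ∀ m → ¬ suc (𝐮 m) < d → 𝐮 (pos m + 1) ≡ E
  𝐮-pos+1-long m ¬p = Occ-letter (0 ∷ []) E (E ∷ []) (Occ-block m (φ₁-long d (𝐮 m) ¬p))

  𝐮-pos+2-long : ∀ m → ¬ suc (𝐮 m) < d → 𝐮 (pos m + 2) ≡ E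
  𝐮-pos+2-long m ¬p = Occ-letter (0 ∷ E ∷ []) E [] (Occ-block m (φ₁-long d (𝐮 m) ¬p))

  decompose : ∀ i → Σ ℕ λ m → Σ ℕ λ r → pos m + r ≡ i × r < length (φ₁ d (𝐮 m))
  decompose zero = 0 , 0 , trans (+-identityʳ (pos 0)) pos-0 , ≤-trans (s≤s z≤n) (2≤length-φ₁ d (𝐮 0))
  decompose (suc i) with decompose i
  ... | m , r , eq , r<ℓ with suc r <? length (φ₁ d (𝐮 m))
  ...   | yes r+1<ℓ = m , suc r , trans (+-suc (pos m) r) (cong suc eq) , r+1<ℓ
  ...   | no  r+1≮ℓ = suc m , 0 , next-block , ≤-trans (s≤s z≤n) (2≤length-φ₁ d (𝐮 (suc m)))
    where
    next-block : pos (suc m) + 0 ≡ suc i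
    next-block = begin
      pos (suc m) + 0                    ≡⟨ +-identityʳ _ ⟩
      pos (suc m)                        ≡⟨ pos-suc m refl ⟩
      pos m + length (φ₁ d (𝐮 m))        ≡⟨ cong (pos m +_) (≤-antisym (≮⇒≥ r+1≮ℓ) r<ℓ) ⟩
      pos m + suc r                      ≡⟨ +-suc (pos m) r ⟩
      suc (pos m + r)                    ≡⟨ cong suc eq ⟩
      suc i                              ∎
      where open ≡-Reasoning

  data Parse (i : ℕ) : Set where
    first  : ∀ m → pos m ≡ i → Parse i
    second : ∀ m → pos m + 1 ≡ i → Parse i
    third  : ∀ m → pos m + 2 ≡ i → ¬ suc (𝐮 m) < d → Parse i

  parse : ∀ i → Parse i
  parse i with decompose i
  ... | m , 0 , eq , _ = first m (trans (sym (+-identityʳ (pos m))) eq)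
  ... | m , 1 , eq , _ = second m eq
  ... | m , 2 , eq , 2<ℓ = third m eq λ p → <-irrefl refl (subst (λ w → 2 < length w) (φ₁-short d (𝐮 m) p) 2<ℓ)
  ... | m , suc (suc (suc r)) , _ , r+3<ℓ with φ₁-view d (𝐮 m)
  ...   | short _ eq = ⊥-elim (<⇒≱ r+3<ℓ (subst (λ w → length w ≤ 3 + r) (sym eq) (s≤s (s≤s z≤n))))
  ...   | long  _ eq = ⊥-elim (<⇒≱ r+3<ℓ (subst (λ w → length w ≤ 3 + r) (sym eq) (s≤s (s≤s (s≤s z≤n)))))

  zero⇒pos : ∀ i → 𝐮 i ≡ 0 → Σ ℕ λ m → pos m ≡ i
  zero⇒pos i 𝐮i≡0 with parse i
  ... | first m eq = m , eq
  ... | third m eq ¬p = ⊥-elim (0≢1+n (trans (sym 𝐮i≡0) (trans (cong 𝐮 (sym eq)) (𝐮-pos+2-long m ¬p))))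
  ... | second m eq with suc (𝐮 m) <? d
  ...   | yes p = ⊥-elim (0≢1+n (trans (sym 𝐮i≡0) (trans (cong 𝐮 (sym eq)) (𝐮-pos+1-short m p))))
  ...   | no ¬p = ⊥-elim (0≢1+n (trans (sym 𝐮i≡0) (trans (cong 𝐮 (sym eq)) (𝐮-pos+1-long m ¬p))))

  before-nonzero : ∀ i → 𝐮 (suc i) ≢ 0 → 𝐮 i ≡ 0 ⊎ 𝐮 i ≡ E
  before-nonzero i ≢0 with parse (suc i)
  ... | first m eq = ⊥-elim (≢0 (trans (cong 𝐮 (sym eq)) (𝐮-pos m)))
  ... | second m eq = inj₁ (subst (λ j → 𝐮 j ≡ 0) pos≡i (𝐮-pos m))
    where
    pos≡i : pos m ≡ i
    pos≡i = suc-injective (trans (+-comm 1 (pos m)) eq)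
  ... | third m eq ¬p = inj₂ (subst (λ j → 𝐮 j ≡ E) pos+1≡i (𝐮-pos+1-long m ¬p))
    where
    pos+1≡i : pos m + 1 ≡ i
    pos+1≡i = suc-injective (trans (sym (+-suc (pos m) 1)) eq)

  after-E : ∀ i → 𝐮 i ≡ E → 𝐮 (suc i) ≡ 0 ⊎ 𝐮 (suc i) ≡ E
  after-E i 𝐮i≡E with parse i
  ... | first m eq = ⊥-elim (0≢1+n (trans (sym (𝐮-pos m)) (trans (cong 𝐮 eq) 𝐮i≡E)))
  ... | third m eq ¬p = inj₁ (subst (λ j → 𝐮 j ≡ 0) next (𝐮-pos (suc m)))
    where
    next : pos (suc m) ≡ suc i
    next = trans (pos-suc m (φ₁-long d (𝐮 m) ¬p)) (trans (+-suc (pos m) 2) (cong suc eq))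
  ... | second m eq with φ₁-view d (𝐮 m)
  ...   | short _ φ₁≡ = inj₁ (subst (λ j → 𝐮 j ≡ 0) next (𝐮-pos (suc m)))
    where
    next : pos (suc m) ≡ suc i
    next = trans (pos-suc m φ₁≡) (trans (+-suc (pos m) 1) (cong suc eq))
  ...   | long ¬p _ = inj₂ (subst (λ j → 𝐮 j ≡ E) next (𝐮-pos+2-long m ¬p))
    where
    next : pos m + 2 ≡ suc i
    next = trans (+-suc (pos m) 1) (cong suc eq)

  middle-letter : ∀ i → 0 < 𝐮 i → 𝐮 i < E → Σ ℕ λ m → pos m + 1 ≡ i × suc (𝐮 m) ≡ 𝐮 i
  middle-letter i 0<𝐮i 𝐮i<E with parse i
  ... | first m eq = ⊥-elim (<⇒≢ 0<𝐮i (sym (trans (cong 𝐮 (sym eq)) (𝐮-pos m))))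
  ... | third m eq ¬p = ⊥-elim (<⇒≢ 𝐮i<E (trans (cong 𝐮 (sym eq)) (𝐮-pos+2-long m ¬p)))
  ... | second m eq with suc (𝐮 m) <? d
  ...   | yes p = m , eq , trans (sym (𝐮-pos+1-short m p)) (cong 𝐮 eq)
  ...   | no ¬p = ⊥-elim (<⇒≢ 𝐮i<E (trans (cong 𝐮 (sym eq)) (𝐮-pos+1-long m ¬p)))

  φ₁-All< : ∀ {k} x → x < k → All (_< suc k) (φ₁ d x)
  φ₁-All< {k} x x<k with φ₁-view d x
  ... | short _  eq rewrite eq = s≤s z≤n ∷ s≤s x<k ∷ []
  ... | long  ¬p eq rewrite eq = s≤s z≤n ∷ E<1+k ∷ E<1+k ∷ []
    where
    E<1+k : E < suc k
    E<1+k = s≤s (≤-trans (≤-pred (≮⇒≥ ¬p)) (<⇒≤ x<k))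

  φ-All< : ∀ {k} v → All (_< k) v → All (_< suc k) (φ d v)
  φ-All< []      []         = []
  φ-All< (x ∷ v) (x<k ∷ v<k) = All.++⁺ (φ₁-All< x x<k) (φ-All< v v<k)

  φ-All<d : ∀ v → All (_< d) (φ d v)
  φ-All<d []      = []
  φ-All<d (x ∷ v) = All.++⁺ (φ₁<d (φ₁-view d x)) (φ-All<d v)
    where
    φ₁<d : φ₁-View d x → All (_< d) (φ₁ d x)
    φ₁<d (short p eq) rewrite eq = s≤s z≤n ∷ p ∷ []
    φ₁<d (long _ eq)  rewrite eq = s≤s z≤n ∷ E<d ∷ E<d ∷ []

  𝐮<d : ∀ n → 𝐮 n < d
  𝐮<d n = subst (_< d) (sym (𝐮-Φ (suc n) n n<Φ)) (All-at n (φ-All<d (Φ n)) n<Φ)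
    where
    n<Φ : n < length (Φ (suc n))
    n<Φ = <-trans (n<1+n n) (N<length-Φ (suc n))

  F-All< : ∀ k → All (_< k) (F d k)
  F-All< zero    = []
  F-All< (suc k) = All.++⁺ (φ-All< (F d k) (F-All< k)) (s≤s z≤n ∷ [])

  -- σ c = min (c + 1) (d - 1) is the second letter of φ(c);
  -- φ^k(y) begins with F_k σ^k(y) and ends with σ^k(y).
  σ : ℕ → ℕ
  σ c = at (φ₁ d c) 1

  σ^ : ℕ → ℕ → ℕ
  σ^ zero    y = y
  σ^ (suc k) y = σ (σ^ k y)

  σ-short : ∀ c → suc c < d → σ c ≡ suc c
  σ-short c p rewrite φ₁-short d c p = refl

  σ-E : σ E ≡ E
  σ-E rewrite φ₁-long d E (<-irrefl refl) = refl

  φ₁-head : ∀ c → Σ Word λ t → φ₁ d c ≡ 0 ∷ σ c ∷ t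
  φ₁-head c with φ₁-view d c
  ... | short _ eq rewrite eq = [] , refl
  ... | long  _ eq rewrite eq = E ∷ [] , refl

  φ₁-last : ∀ c → Σ Word λ t → φ₁ d c ≡ t ++ σ c ∷ []
  φ₁-last c with φ₁-view d c
  ... | short _ eq rewrite eq = 0 ∷ [] , refl
  ... | long  _ eq rewrite eq = 0 ∷ E ∷ [] , refl

  starts-with-0 : ∀ v t → Σ Word λ t′ → φ d v ++ 0 ∷ t ≡ 0 ∷ t′
  starts-with-0 []      t = t , refl
  starts-with-0 (x ∷ v) t with φ₁-head x
  ... | t₁ , eq = σ x ∷ t₁ ++ φ d v ++ 0 ∷ t ,
    trans (++-assoc (φ₁ d x) (φ d v) _) (cong (_++ (φ d v ++ 0 ∷ t)) eq)

  φ^-head : ∀ k y → Σ Word λ t → φ^ d k (y ∷ []) ≡ F d k ++ σ^ k y ∷ t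
  φ^-head zero    y = [] , refl
  φ^-head (suc k) y with φ^-head k y | φ₁-head (σ^ k y)
  ... | t , eq | t₁ , eq₁ = t₁ ++ φ d t , (begin
    φ d (φ^ d k (y ∷ []))                              ≡⟨ cong (φ d) eq ⟩
    φ d (F d k ++ σ^ k y ∷ t)                          ≡⟨ φ-++ d (F d k) (σ^ k y ∷ t) ⟩
    φ d (F d k) ++ φ₁ d (σ^ k y) ++ φ d t              ≡⟨ cong (λ w → φ d (F d k) ++ w ++ φ d t) eq₁ ⟩
    φ d (F d k) ++ 0 ∷ σ^ (suc k) y ∷ t₁ ++ φ d t      ≡⟨ ++-assoc (φ d (F d k)) (0 ∷ []) _ ⟨
    F d (suc k) ++ σ^ (suc k) y ∷ t₁ ++ φ d t          ∎)
    where open ≡-Reasoning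

  φ^-last : ∀ k y → Σ Word λ t → φ^ d k (y ∷ []) ≡ t ++ σ^ k y ∷ []
  φ^-last zero    y = [] , refl
  φ^-last (suc k) y with φ^-last k y | φ₁-last (σ^ k y)
  ... | t , eq | t₁ , eq₁ = φ d t ++ t₁ , (begin
    φ d (φ^ d k (y ∷ []))                 ≡⟨ cong (φ d) eq ⟩
    φ d (t ++ σ^ k y ∷ [])                ≡⟨ φ-++ d t (σ^ k y ∷ []) ⟩
    φ d t ++ φ₁ d (σ^ k y) ++ []          ≡⟨ cong (φ d t ++_) (trans (++-identityʳ _) eq₁) ⟩
    φ d t ++ t₁ ++ σ^ (suc k) y ∷ []      ≡⟨ ++-assoc (φ d t) t₁ _ ⟨
    (φ d t ++ t₁) ++ σ^ (suc k) y ∷ []    ∎)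
    where open ≡-Reasoning

  σ^-small : ∀ k y → y + k < d → σ^ k y ≡ y + k
  σ^-small zero    y _   = sym (+-identityʳ y)
  σ^-small (suc k) y lt  = begin
    σ (σ^ k y)       ≡⟨ cong σ (σ^-small k y (<-trans (n<1+n _) lt′)) ⟩
    σ (y + k)        ≡⟨ σ-short (y + k) lt′ ⟩
    suc (y + k)      ≡⟨ +-suc y k ⟨
    y + suc k        ∎
    where
    open ≡-Reasoning
    lt′ : suc (y + k) < d
    lt′ = subst (_< d) (+-suc y k) lt

  σ^-E : ∀ k y → y < d → E ≤ y + k → σ^ k y ≡ E
  σ^-E zero    y y<d E≤y = ≤-antisym (≤-pred y<d) (subst (E ≤_) (+-identityʳ y) E≤y)
  σ^-E (suc k) y y<d E≤y with E ≤? y + k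
  ... | yes E≤ = trans (cong σ (σ^-E k y y<d E≤)) σ-E
  ... | no  E≰ = trans (cong σ (σ^-small k y (<-trans y+k<E E<d))) (trans (σ-short _ (subst (_< d) (sym y+k+1≡E) E<d)) y+k+1≡E)
    where
    y+k<E : y + k < E
    y+k<E = ≰⇒> E≰
    y+k+1≡E : suc (y + k) ≡ E
    y+k+1≡E = ≤-antisym y+k<E (subst (E ≤_) (+-suc y k) E≤y)

  σ^≡E⇒E≤ : ∀ k y → σ^ k y ≡ E → E ≤ y + k
  σ^≡E⇒E≤ k y eq with E ≤? y + k
  ... | yes E≤ = E≤
  ... | no  E≰ = ⊥-elim (<⇒≢ (≰⇒> E≰) (trans (sym (σ^-small k y (<-trans (≰⇒> E≰) E<d))) eq))

  φ^-letter : ∀ j x → x + j < d → φ^ d j (x ∷ []) ≡ F d j ++ (x + j) ∷ []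
  φ^-letter zero    x _  = cong (_∷ []) (sym (+-identityʳ x))
  φ^-letter (suc j) x lt = begin
    φ d (φ^ d j (x ∷ []))                        ≡⟨ cong (φ d) (φ^-letter j x (<-trans (n<1+n _) lt′)) ⟩
    φ d (F d j ++ (x + j) ∷ [])                  ≡⟨ φ-++ d (F d j) _ ⟩
    φ d (F d j) ++ φ₁ d (x + j) ++ []            ≡⟨ cong (λ w → φ d (F d j) ++ w ++ []) (φ₁-short d (x + j) lt′) ⟩
    φ d (F d j) ++ 0 ∷ suc (x + j) ∷ []          ≡⟨ ++-assoc (φ d (F d j)) (0 ∷ []) _ ⟨
    F d (suc j) ++ suc (x + j) ∷ []              ≡⟨ cong (λ y → F d (suc j) ++ y ∷ []) (+-suc x j) ⟨
    F d (suc j) ++ (x + suc j) ∷ []              ∎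
    where
    open ≡-Reasoning
    lt′ : suc (x + j) < d
    lt′ = subst (_< d) (+-suc x j) lt

  Occ-φ⁻ : ∀ {m} v → All (_< suc e) v → Occ (pos m) (φ d v) → Occ m v
  Occ-φ⁻ []      _                   _ = refl
  Occ-φ⁻ {m} (x ∷ v) (x<1+e ∷ v<1+e) o = cong₂ _∷_ 𝐮m≡x (Occ-φ⁻ v v<1+e o-rest)
    where
    x+1<d : suc x < d
    x+1<d = <-trans (s≤s x<1+e) E<d
    o′ : Occ (pos m) (0 ∷ suc x ∷ φ d v)
    o′ = subst (λ w → Occ (pos m) (w ++ φ d v)) (φ₁-short d x x+1<d) o
    𝐮⟨pos+1⟩≡ : 𝐮 (pos m + 1) ≡ suc x
    𝐮⟨pos+1⟩≡ = Occ-letter (0 ∷ []) (suc x) (φ d v) o′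
    𝐮m≡x : 𝐮 m ≡ x
    𝐮m≡x with φ₁-view d (𝐮 m)
    ... | short p _ = suc-injective (trans (sym (𝐮-pos+1-short m p)) 𝐮⟨pos+1⟩≡)
    ... | long ¬p _ = ⊥-elim (<⇒≢ (s≤s x<1+e) (trans (sym 𝐮⟨pos+1⟩≡) (𝐮-pos+1-long m ¬p)))
    o-rest : Occ (pos (suc m)) (φ d v)
    o-rest = subst (λ j → Occ j (φ d v)) (sym (pos-suc m (trans (cong (φ₁ d) 𝐮m≡x) (φ₁-short d x x+1<d))))
                   (Occ-++⁻ʳ (0 ∷ suc x ∷ []) (φ d v) o′)

  φ-0∷-at-pos : ∀ {i} v t → Occ i (φ d v ++ 0 ∷ t) → Σ ℕ λ m → pos m ≡ i
  φ-0∷-at-pos {i} v t o with starts-with-0 v t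
  ... | t′ , eq = zero⇒pos i (Occ-head (subst (Occ i) eq o))

  synchronise : ∀ k → k ≤ E → ∀ {i c} → k ≤ c → Occ i (F d k ++ c ∷ []) → Σ ℕ λ m → pos^ k m ≡ i
  synchronise zero    _   {i} _ _ = i , refl
  synchronise (suc k) k<E {i} {c} k<c o with φ-0∷-at-pos (F d k) (c ∷ []) (subst (Occ i) (++-assoc _ (0 ∷ []) _) o)
  ... | m , refl = proj₁ ih , cong pos (proj₂ ih)
    where
    o′ : Occ (pos m) (φ d (F d k) ++ 0 ∷ c ∷ [])
    o′ = subst (Occ (pos m)) (++-assoc (φ d (F d k)) (0 ∷ []) (c ∷ [])) o
    oF : Occ m (F d k)
    oF = Occ-φ⁻ (F d k) (All.map (λ p → ≤-trans p (≤-pred k<E)) (F-All< k)) (Occ-++⁻ˡ (φ d (F d k)) _ o′)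
    m′ : ℕ
    m′ = m + length (F d k)
    𝐮⟨pos+1⟩≡c : 𝐮 (pos m′ + 1) ≡ c
    𝐮⟨pos+1⟩≡c = trans (cong (λ j → 𝐮 (j + 1)) (pos-+ oF))
      (Occ-letter (0 ∷ []) c [] (Occ-++⁻ʳ (φ d (F d k)) (0 ∷ c ∷ []) o′))
    k≤𝐮m′ : k ≤ 𝐮 m′
    k≤𝐮m′ with φ₁-view d (𝐮 m′)
    ... | short p _ = ≤-pred (subst (suc k ≤_) (trans (sym 𝐮⟨pos+1⟩≡c) (𝐮-pos+1-short m′ p)) k<c)
    ... | long ¬p _ = ≤-trans (<⇒≤ k<E) (≤-pred (≮⇒≥ ¬p))
    ih : Σ ℕ λ m₀ → pos^ k m₀ ≡ m
    ih = synchronise k (<⇒≤ k<E) k≤𝐮m′ (Occ-++ (F d k) (𝐮 m′ ∷ []) oF refl)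

  right-of-E : ∀ {i} a c → Occ i (a ++ E ∷ c ∷ []) → c ≡ 0 ⊎ c ≡ E
  right-of-E {i} a c o = subst (λ x → x ≡ 0 ⊎ x ≡ E) (Occ-head (Occ-tail oEc)) (after-E _ (Occ-head oEc))
    where
    oEc : Occ (i + length a) (E ∷ c ∷ [])
    oEc = Occ-++⁻ʳ a (E ∷ c ∷ []) o

  𝐮-length-F-E : 𝐮 (length (F d E)) ≡ E
  𝐮-length-F-E = Occ-letter (F d E) E [] (subst (Occ 0) (φ^-letter E 0 E<d) (Occ-Φ E))

  φ₁-E : φ₁ d E ≡ 0 ∷ E ∷ E ∷ []
  φ₁-E = φ₁-long d E (<-irrefl refl)

  EE-occurs : Σ ℕ λ m → 𝐮 m ≡ E × 𝐮 (suc m) ≡ E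
  EE-occurs = pos m + 1 , Occ-letter (0 ∷ []) E (E ∷ []) block ,
              trans (cong 𝐮 (sym (+-suc (pos m) 1))) (Occ-letter (0 ∷ E ∷ []) E [] block)
    where
    m : ℕ
    m = length (F d E)
    block : Occ (pos m) (0 ∷ E ∷ E ∷ [])
    block = Occ-block m (trans (cong (φ₁ d) 𝐮-length-F-E) φ₁-E)

  F-E-E-occurs : ∀ k → Σ ℕ λ i → Occ i (F d k ++ E ∷ E ∷ [])
  F-E-E-occurs zero    = proj₁ EE-occurs , cong₂ _∷_ (proj₁ (proj₂ EE-occurs)) (cong (_∷ []) (proj₂ (proj₂ EE-occurs)))
  F-E-E-occurs (suc k) =
    pos^ (suc k) m , Occ-++⁻ˡ (F d (suc k) ++ E ∷ E ∷ []) (φ d t) (subst (Occ _) image (Occ-φ^-𝐮 (suc k) m))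
    where
    m : ℕ
    m = length (F d E)
    t : Word
    t = proj₁ (φ^-head k E)
    image : φ^ d (suc k) (𝐮 m ∷ []) ≡ (F d (suc k) ++ E ∷ E ∷ []) ++ φ d t
    image = begin
      φ d (φ^ d k (𝐮 m ∷ []))                    ≡⟨ cong (λ x → φ d (φ^ d k (x ∷ []))) 𝐮-length-F-E ⟩
      φ d (φ^ d k (E ∷ []))                      ≡⟨ cong (φ d) (proj₂ (φ^-head k E)) ⟩
      φ d (F d k ++ σ^ k E ∷ t)                  ≡⟨ cong (λ x → φ d (F d k ++ x ∷ t)) (σ^-E k E E<d (m≤m+n E k)) ⟩
      φ d (F d k ++ E ∷ t)                       ≡⟨ φ-++ d (F d k) (E ∷ t) ⟩
      φ d (F d k) ++ φ₁ d E ++ φ d t             ≡⟨ cong (λ w → φ d (F d k) ++ w ++ φ d t) φ₁-E ⟩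
      φ d (F d k) ++ 0 ∷ E ∷ E ∷ φ d t           ≡⟨ ++-assoc (φ d (F d k)) (0 ∷ []) _ ⟨
      F d (suc k) ++ E ∷ E ∷ φ d t               ≡⟨ ++-assoc (F d (suc k)) (E ∷ E ∷ []) (φ d t) ⟨
      (F d (suc k) ++ E ∷ E ∷ []) ++ φ d t       ∎
      where open ≡-Reasoning

  slice-factor-++ : ∀ j L W → Occ (j + L) W → slice d j ((j + L + length W) ∸ j) ≡ factor j L ++ W
  slice-factor-++ j L W o = begin
    slice d j ((j + L + length W) ∸ j)     ≡⟨ slice≡factor j _ ⟩
    factor j ((j + L + length W) ∸ j)      ≡⟨ cong (λ n → factor j (n ∸ j)) (+-assoc j L (length W)) ⟩
    factor j ((j + (L + length W)) ∸ j)    ≡⟨ cong (factor j) (m+n∸m≡n j (L + length W)) ⟩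
    factor j (L + length W)                ≡⟨ factor-+ j L (length W) ⟩
    factor j L ++ factor (j + L) (length W) ≡⟨ cong (factor j L ++_) o ⟩
    factor j L ++ W                        ∎
    where open ≡-Reasoning

  F-follows : ∀ t m → t ≤ 𝐮 m → 𝐮 m < E → Occ (suc m) (F d t)
  F-follows zero    m _   _   = refl
  F-follows (suc t) m t<𝐮 𝐮<E with middle-letter m (<-≤-trans (s≤s z≤n) t<𝐮) 𝐮<E
  ... | m₀ , refl , 𝐮m₀+1≡ =
    subst (λ i → Occ i (F d (suc t))) pos-suc-m₀ (Occ-++ (φ d (F d t)) (0 ∷ []) (Occ-φ oF) then-0)
    where
    oF : Occ (suc m₀) (F d t)
    oF = F-follows t m₀ (≤-pred (subst (suc t ≤_) (sym 𝐮m₀+1≡) t<𝐮)) (<-trans (n<1+n _) (subst (_< E) (sym 𝐮m₀+1≡) 𝐮<E))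
    pos-suc-m₀ : pos (suc m₀) ≡ suc (pos m₀ + 1)
    pos-suc-m₀ = trans (pos-suc m₀ (φ₁-short d (𝐮 m₀) (<-trans (subst (_< E) (sym 𝐮m₀+1≡) 𝐮<E) E<d))) (+-suc (pos m₀) 1)
    then-0 : Occ (pos (suc m₀) + length (φ d (F d t))) (0 ∷ [])
    then-0 = cong (_∷ []) (trans (cong 𝐮 (sym (pos-+ oF))) (𝐮-pos _))

  letter-before-pos^ : ∀ k m → Σ ℕ λ p → suc p ≡ pos^ k (suc m) × 𝐮 p ≡ σ^ k (𝐮 m)
  letter-before-pos^ k m with φ^-last k (𝐮 m)
  ... | t , eq = p , p+1≡ , Occ-letter t _ [] (subst (Occ (pos^ k m)) eq (Occ-φ^-𝐮 k m))
    where
    p : ℕ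
    p = pos^ k m + length t
    p+1≡ : suc p ≡ pos^ k (suc m)
    p+1≡ = sym (begin
      pos^ k (suc m)                                ≡⟨ pos^-suc k m ⟩
      pos^ k m + length (φ^ d k (𝐮 m ∷ []))         ≡⟨ cong (λ v → pos^ k m + length v) eq ⟩
      pos^ k m + length (t ++ σ^ k (𝐮 m) ∷ [])      ≡⟨ cong (pos^ k m +_) (trans (length-++ t) (+-comm (length t) 1)) ⟩
      pos^ k m + suc (length t)                     ≡⟨ +-suc (pos^ k m) (length t) ⟩
      suc p                                         ∎)
      where open ≡-Reasoning

module ShortCase (e k t : ℕ) (k+τ≡E : k + suc t ≡ 2 + e) where
  open FixedPoint e

  τ : ℕ
  τ = suc t

  w : Word
  w = F d k ++ E ∷ []

  k<E : k < E
  k<E = subst (k <_) k+τ≡E (m<m+n k (s≤s z≤n))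

  τ≤E : τ ≤ E
  τ≤E = subst (τ ≤_) k+τ≡E (m≤n+m τ k)

  E≤⇒τ≤ : ∀ y → E ≤ y + k → τ ≤ y
  E≤⇒τ≤ y le = +-cancelˡ-≤ k τ y (subst₂ _≤_ (sym k+τ≡E) (+-comm y k) le)

  τ≤⇒E≤ : ∀ y → τ ≤ y → E ≤ y + k
  τ≤⇒E≤ y le = subst₂ _≤_ k+τ≡E (+-comm k y) (+-monoʳ-≤ k le)

  φ^-marked : ∀ m → τ ≤ 𝐮 m → Σ Word λ t → φ^ d k (𝐮 m ∷ []) ≡ w ++ t
  φ^-marked m τ≤𝐮 with φ^-head k (𝐮 m)
  ... | t , eq = t , trans eq (trans (cong (λ x → F d k ++ x ∷ t) (σ^-E k (𝐮 m) (𝐮<d m) (τ≤⇒E≤ (𝐮 m) τ≤𝐮)))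
                                    (sym (++-assoc (F d k) (E ∷ []) t)))

  Occ-w : ∀ m → τ ≤ 𝐮 m → Occ (pos^ k m) w
  Occ-w m τ≤𝐮 with φ^-marked m τ≤𝐮
  ... | t , eq = Occ-++⁻ˡ w t (subst (Occ (pos^ k m)) eq (Occ-φ^-𝐮 k m))

  Occ-w⁻ : ∀ {i} → Occ i w → Σ ℕ λ m → pos^ k m ≡ i × τ ≤ 𝐮 m
  Occ-w⁻ o with synchronise k (<⇒≤ k<E) (<⇒≤ k<E) o
  ... | m , refl with φ^-head k (𝐮 m)
  ... | t , eq = m , refl , E≤⇒τ≤ (𝐮 m) (σ^≡E⇒E≤ k (𝐮 m) σ^≡E)
    where
    σ^≡E : σ^ k (𝐮 m) ≡ E
    σ^≡E = trans (sym (Occ-letter (F d k) _ t (subst (Occ (pos^ k m)) eq (Occ-φ^-𝐮 k m)))) (Occ-letter (F d k) E [] o)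

  φ^-τ : φ^ d k (τ ∷ []) ≡ w
  φ^-τ = trans (φ^-letter k τ (subst (_< d) (sym τ+k≡E) E<d)) (cong (λ x → F d k ++ x ∷ []) τ+k≡E)
    where
    τ+k≡E : τ + k ≡ E
    τ+k≡E = trans (+-comm τ k) k+τ≡E

  φ^E-0 : φ^ d E (0 ∷ []) ≡ φ^ d k (F d τ) ++ w
  φ^E-0 = begin
    φ^ d E (0 ∷ [])                       ≡⟨ cong (λ n → φ^ d n (0 ∷ [])) k+τ≡E ⟨
    φ^ d (k + τ) (0 ∷ [])                 ≡⟨ φ^-+ d k τ (0 ∷ []) ⟩
    φ^ d k (φ^ d τ (0 ∷ []))              ≡⟨ cong (φ^ d k) (φ^-letter τ 0 (s≤s τ≤E)) ⟩
    φ^ d k (F d τ ++ τ ∷ [])              ≡⟨ φ^-++ d k (F d τ) (τ ∷ []) ⟩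
    φ^ d k (F d τ) ++ φ^ d k (τ ∷ [])     ≡⟨ cong (φ^ d k (F d τ) ++_) φ^-τ ⟩
    φ^ d k (F d τ) ++ w                   ∎
    where open ≡-Reasoning

  marked-after : ∀ {m₁ m₂} V → All (_< τ) V → Occ (suc m₁) V → m₁ < m₂ → τ ≤ 𝐮 m₂ → suc m₁ + length V ≤ m₂
  marked-after {m₁} {m₂} V V<τ oV m₁<m₂ τ≤𝐮 with suc m₁ + length V ≤? m₂
  ... | yes le = le
  ... | no  gt = ⊥-elim (<⇒≱ (subst (_< τ) (sym 𝐮m₂≡) (All-at r V<τ r<V)) τ≤𝐮)
    where
    r : ℕ
    r = m₂ ∸ suc m₁
    m₁+r≡m₂ : suc m₁ + r ≡ m₂
    m₁+r≡m₂ = m+[n∸m]≡n m₁<m₂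
    r<V : r < length V
    r<V = +-cancelˡ-< (suc m₁) r (length V) (subst (_< suc m₁ + length V) (sym m₁+r≡m₂) (≰⇒> gt))
    𝐮m₂≡ : 𝐮 m₂ ≡ at V r
    𝐮m₂≡ = trans (cong 𝐮 (sym m₁+r≡m₂)) (Occ-at r oV r<V)

  slice-φ^ : ∀ {m ℓ} v → Occ m v → m + length v ≡ ℓ → Occ (pos^ k ℓ) w →
             slice d (pos^ k m) ((pos^ k ℓ + length w) ∸ pos^ k m) ≡ φ^ d k v ++ w
  slice-φ^ {m} v oV refl oW rewrite pos^-+ k oV =
    trans (slice-factor-++ (pos^ k m) _ w oW) (cong (_++ w) (Occ-φ^ k oV))

  return-word : ∀ m V → τ ≤ 𝐮 m → All (_< τ) V → Occ (suc m) V → τ ≤ 𝐮 (suc m + length V) →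
                IsCompleteReturnWord d w (φ^ d k (𝐮 m ∷ V) ++ w)
  return-word m V τ≤𝐮m V<τ oV τ≤𝐮ℓ =
    pos^ k m , pos^ k (suc m + length V) , pos^-mono-< k (s≤s (m≤m+n m (length V))) ,
    Occ⇒OccursAt (Occ-w m τ≤𝐮m) , Occ⇒OccursAt (Occ-w _ τ≤𝐮ℓ) , no-w-between ,
    sym (slice-φ^ (𝐮 m ∷ V) (cong₂ _∷_ refl oV) (+-suc m (length V)) (Occ-w _ τ≤𝐮ℓ))
    where
    no-w-between : ∀ i → pos^ k m < i → i < pos^ k (suc m + length V) → ¬ OccursAt d w i
    no-w-between i m<i i<ℓ oi with Occ-w⁻ {i} (OccursAt⇒Occ oi)
    ... | m₂ , refl , τ≤𝐮m₂ = <⇒≱ (pos^-cancel-< k i<ℓ) (marked-after V V<τ oV (pos^-cancel-< k m<i) τ≤𝐮m₂)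

  return-word-A : IsCompleteReturnWord d w (φ^ d k (E ∷ []) ++ w)
  return-word-A with EE-occurs
  ... | m , 𝐮m≡E , 𝐮m+1≡E = subst (λ x → IsCompleteReturnWord d w (φ^ d k (x ∷ []) ++ w)) 𝐮m≡E
    (return-word m [] (subst (τ ≤_) (sym 𝐮m≡E) τ≤E) [] refl
      (subst (τ ≤_) (sym (trans (cong (𝐮 ∘ suc) (+-identityʳ m)) 𝐮m+1≡E)) τ≤E))

  τ≤σ^τ1 : τ ≤ σ^ τ 1
  τ≤σ^τ1 with E ≤? 1 + τ
  ... | yes E≤ = subst (τ ≤_) (sym (σ^-E τ 1 (s≤s (s≤s z≤n)) E≤)) τ≤E
  ... | no  E≰ = subst (τ ≤_) (sym (σ^-small τ 1 (<-trans (≰⇒> E≰) E<d))) (n≤1+n τ)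

  -- Read off from φ^(τ+1)(0) = F_τ τ F_τ σ^τ(1) ⋯.
  τ-F-occurs : Σ ℕ λ m → 𝐮 m ≡ τ × Occ (suc m) (F d τ) × τ ≤ 𝐮 (suc m + length (F d τ))
  τ-F-occurs with φ^-head τ 1
  ... | t₁ , eq = length (F d τ) , Occ-letter (F d τ) τ _ o , Occ-++⁻ˡ (F d τ) _ after-τ ,
                  subst (τ ≤_) (sym (Occ-letter (F d τ) (σ^ τ 1) t₁ after-τ)) τ≤σ^τ1
    where
    prefix : Φ (suc τ) ≡ F d τ ++ τ ∷ F d τ ++ σ^ τ 1 ∷ t₁
    prefix = trans (Φ-suc τ) (trans (cong₂ _++_ (φ^-letter τ 0 (s≤s τ≤E)) eq) (++-assoc (F d τ) (τ ∷ []) _))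
    o : Occ 0 (F d τ ++ τ ∷ F d τ ++ σ^ τ 1 ∷ t₁)
    o = subst (Occ 0) prefix (Occ-Φ (suc τ))
    after-τ : Occ (suc (length (F d τ))) (F d τ ++ σ^ τ 1 ∷ t₁)
    after-τ = Occ-tail (Occ-++⁻ʳ (F d τ) _ o)

  φ^-τ∷F : φ^ d k (τ ∷ F d τ) ++ w ≡ w ++ φ^ d E (0 ∷ [])
  φ^-τ∷F = begin
    φ^ d k (τ ∷ F d τ) ++ w                     ≡⟨ cong (_++ w) (φ^-∷ d k τ (F d τ)) ⟩
    (φ^ d k (τ ∷ []) ++ φ^ d k (F d τ)) ++ w    ≡⟨ cong (λ v → (v ++ φ^ d k (F d τ)) ++ w) φ^-τ ⟩
    (w ++ φ^ d k (F d τ)) ++ w                  ≡⟨ ++-assoc w (φ^ d k (F d τ)) w ⟩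
    w ++ φ^ d k (F d τ) ++ w                    ≡⟨ cong (w ++_) φ^E-0 ⟨
    w ++ φ^ d E (0 ∷ [])                        ∎
    where open ≡-Reasoning

  return-word-B : IsCompleteReturnWord d w (w ++ φ^ d E (0 ∷ []))
  return-word-B with τ-F-occurs
  ... | m , 𝐮m≡τ , oF , τ≤𝐮ℓ = subst (IsCompleteReturnWord d w) (trans (cong (λ x → φ^ d k (x ∷ F d τ) ++ w) 𝐮m≡τ) φ^-τ∷F)
    (return-word m (F d τ) (≤-reflexive (sym 𝐮m≡τ)) (F-All< τ) oF τ≤𝐮ℓ)

  return-word-form : ∀ {R} → IsCompleteReturnWord d w R →
    Σ ℕ λ m → Σ ℕ λ n → τ ≤ 𝐮 m × τ ≤ 𝐮 (suc m + n) × R ≡ φ^ d k (𝐮 m ∷ factor (suc m) n) ++ w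
  return-word-form (j , ℓ , j<ℓ , oj , oℓ , _ , R≡)
    with Occ-w⁻ {j} (OccursAt⇒Occ oj) | Occ-w⁻ {ℓ} (OccursAt⇒Occ oℓ)
  ... | m , refl , τ≤𝐮m | m′ , refl , τ≤𝐮m′ = m , n , τ≤𝐮m , subst (λ i → τ ≤ 𝐮 i) (sym m+1+n≡m′) τ≤𝐮m′ ,
    trans R≡ (slice-φ^ (factor m (suc n)) (Occ-factor m (suc n)) m+n≡m′ (OccursAt⇒Occ oℓ))
    where
    n : ℕ
    n = m′ ∸ suc m
    m+1+n≡m′ : suc m + n ≡ m′
    m+1+n≡m′ = m+[n∸m]≡n (pos^-cancel-< k j<ℓ)
    m+n≡m′ : m + length (factor m (suc n)) ≡ m′
    m+n≡m′ = trans (cong (m +_) (length-factor m (suc n))) (trans (+-suc m n) m+1+n≡m′)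

  A≼ : ∀ {m n} → 𝐮 m ≡ E → φ^ d k (E ∷ []) ++ w ≼ φ^ d k (𝐮 m ∷ factor (suc m) n) ++ w
  A≼ {m} {n} 𝐮m≡E = begin
    φ^ d k (E ∷ []) ++ w                                    ≲⟨ ++-mono-≼ (v≼v++w (φ^ d k (E ∷ [])) (φ^ d k (factor (suc m) n))) (≼-refl {w}) ⟩
    (φ^ d k (E ∷ []) ++ φ^ d k (factor (suc m) n)) ++ w    ≡⟨ cong (_++ w) (φ^-∷ d k E _) ⟨
    φ^ d k (E ∷ factor (suc m) n) ++ w                     ≡⟨ cong (λ x → φ^ d k (x ∷ factor (suc m) n) ++ w) 𝐮m≡E ⟨
    φ^ d k (𝐮 m ∷ factor (suc m) n) ++ w                   ∎
    where open import Relation.Binary.Reasoning.Preorder ≼-preorder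

  -- If u_m < d - 1, then u_m is followed by F_τ, all of whose letters are < τ.
  F-prefix-of-gap : ∀ {m n} → τ ≤ 𝐮 m → 𝐮 m < E → τ ≤ 𝐮 (suc m + n) → Σ Word λ tl → factor (suc m) n ≡ F d τ ++ tl
  F-prefix-of-gap {m} {n} τ≤𝐮m 𝐮m<E τ≤𝐮ℓ with Occ-prefix (length (F d τ)) (Occ-factor (suc m) n) F≤n
    where
    oF : Occ (suc m) (F d τ)
    oF = F-follows τ m τ≤𝐮m 𝐮m<E
    F≤n : length (F d τ) ≤ length (factor (suc m) n)
    F≤n = subst (length (F d τ) ≤_) (sym (length-factor (suc m) n))
      (+-cancelˡ-≤ (suc m) _ _ (marked-after (F d τ) (F-All< τ) oF (s≤s (m≤m+n m n)) τ≤𝐮ℓ))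
  ... | tl , eq = tl , trans eq (cong (_++ tl) (F-follows τ m τ≤𝐮m 𝐮m<E))

  B≼ : ∀ {m n} → τ ≤ 𝐮 m → 𝐮 m < E → τ ≤ 𝐮 (suc m + n) → w ++ φ^ d E (0 ∷ []) ≼ φ^ d k (𝐮 m ∷ factor (suc m) n) ++ w
  B≼ {m} {n} τ≤𝐮m 𝐮m<E τ≤𝐮ℓ with φ^-marked m τ≤𝐮m | F-prefix-of-gap {m} {n} τ≤𝐮m 𝐮m<E τ≤𝐮ℓ
  ... | t , φ^𝐮m≡ | tl , fac≡ = begin
    w ++ φ^ d E (0 ∷ [])                                          ≡⟨ cong (w ++_) φ^E-0 ⟩
    w ++ φ^ d k (F d τ) ++ w                                      ≲⟨ ++-mono-≼ (v≼v++w w t)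
                                                                          (++-mono-≼ (≼-refl {φ^ d k (F d τ)}) (w≼v++w (φ^ d k tl) w)) ⟩
    (w ++ t) ++ φ^ d k (F d τ) ++ φ^ d k tl ++ w                  ≡⟨ regroup ⟨
    φ^ d k (𝐮 m ∷ factor (suc m) n) ++ w                          ∎
    where
    open import Relation.Binary.Reasoning.Preorder ≼-preorder
    regroup : φ^ d k (𝐮 m ∷ factor (suc m) n) ++ w ≡ (w ++ t) ++ φ^ d k (F d τ) ++ φ^ d k tl ++ w
    regroup = ≡.begin
      φ^ d k (𝐮 m ∷ factor (suc m) n) ++ w                       ≡.≡⟨ cong (_++ w) (φ^-∷ d k (𝐮 m) _) ⟩
      (φ^ d k (𝐮 m ∷ []) ++ φ^ d k (factor (suc m) n)) ++ w      ≡.≡⟨ cong₂ (λ x y → (x ++ φ^ d k y) ++ w) φ^𝐮m≡ fac≡ ⟩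
      ((w ++ t) ++ φ^ d k (F d τ ++ tl)) ++ w                    ≡.≡⟨ cong (λ x → ((w ++ t) ++ x) ++ w) (φ^-++ d k (F d τ) tl) ⟩
      ((w ++ t) ++ φ^ d k (F d τ) ++ φ^ d k tl) ++ w             ≡.≡⟨ ++-assoc (w ++ t) _ w ⟩
      (w ++ t) ++ (φ^ d k (F d τ) ++ φ^ d k tl) ++ w             ≡.≡⟨ cong ((w ++ t) ++_) (++-assoc (φ^ d k (F d τ)) _ w) ⟩
      (w ++ t) ++ φ^ d k (F d τ) ++ φ^ d k tl ++ w               ≡.∎
      where module ≡ = ≡-Reasoning

  return-word-≽ : ∀ {R} → IsCompleteReturnWord d w R → φ^ d k (E ∷ []) ++ w ≼ R ⊎ w ++ φ^ d E (0 ∷ []) ≼ R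
  return-word-≽ rw with return-word-form rw
  ... | m , n , τ≤𝐮m , τ≤𝐮ℓ , refl with 𝐮 m ≟ E
  ...   | yes 𝐮m≡E = inj₁ (A≼ 𝐮m≡E)
  ...   | no  𝐮m≢E = inj₂ (B≼ τ≤𝐮m (≤∧≢⇒< (≤-pred (𝐮<d m)) 𝐮m≢E) τ≤𝐮ℓ)

  preceding-letter : ∀ m → τ ≤ 𝐮 (suc m) → Σ ℕ λ p → suc p ≡ pos^ k (suc m) × Occ p (σ^ k (𝐮 m) ∷ w)
  preceding-letter m τ≤𝐮 with letter-before-pos^ k m
  ... | p , p+1≡ , 𝐮p≡ = p , p+1≡ , cong₂ _∷_ 𝐮p≡ (subst (λ i → Occ i w) (sym p+1≡) (Occ-w (suc m) τ≤𝐮))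

  σ^-0 : σ^ k 0 ≡ k
  σ^-0 = σ^-small k 0 (<-trans k<E E<d)

  σ^-E′ : σ^ k E ≡ E
  σ^-E′ = σ^-E k E E<d (m≤m+n E k)

  k∷w-occurs : Σ ℕ λ i → Occ i (k ∷ w)
  k∷w-occurs with τ-F-occurs
  ... | m , _ , oF , τ≤𝐮ℓ with preceding-letter (m + length (F d τ)) τ≤𝐮ℓ
  ...   | p , _ , o = p , subst (λ x → Occ p (x ∷ w)) (trans (cong (σ^ k) last-F≡0) σ^-0) o
    where
    last-F≡0 : 𝐮 (m + length (F d τ)) ≡ 0
    last-F≡0 = trans (cong 𝐮 (trans (cong (m +_) (trans (length-++ (φ d (F d t))) (+-comm _ 1))) (+-suc m _)))
                     (Occ-letter (φ d (F d t)) 0 [] oF)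

  E∷w-occurs : Σ ℕ λ i → Occ i (E ∷ w)
  E∷w-occurs with EE-occurs
  ... | m , 𝐮m≡E , 𝐮m+1≡E with preceding-letter m (subst (τ ≤_) (sym 𝐮m+1≡E) τ≤E)
  ...   | p , _ , o = p , subst (λ x → Occ p (x ∷ w)) (trans (cong (σ^ k) 𝐮m≡E) σ^-E′) o

  σ^-0-or-E : ∀ {y} → y ≡ 0 ⊎ y ≡ E → σ^ k y ≡ k ⊎ σ^ k y ≡ E
  σ^-0-or-E (inj₁ refl) = inj₁ σ^-0
  σ^-0-or-E (inj₂ refl) = inj₂ σ^-E′

  -- w is preceded by the last letter of φ^k(u_m), and u_m ∈ {0, d-1} since u_{m+1} ≠ 0.
  left-extensions : ∀ {i c} → Occ i (c ∷ w) → c ≡ k ⊎ c ≡ E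
  left-extensions {i} {c} o with Occ-w⁻ {suc i} (Occ-tail o)
  ... | zero , 0≡1+i , _ = ⊥-elim (0≢1+n (trans (sym (pos^-0 k)) 0≡1+i))
  ... | suc m , eq , τ≤𝐮 with preceding-letter m τ≤𝐮
  ...   | p , p+1≡ , oσ = subst (λ x → x ≡ k ⊎ x ≡ E) (sym c≡σ^)
                            (σ^-0-or-E (before-nonzero m λ 𝐮≡0 → <⇒≢ (<-≤-trans (s≤s z≤n) τ≤𝐮) (sym 𝐮≡0)))
    where
    c≡σ^ : c ≡ σ^ k (𝐮 m)
    c≡σ^ = trans (sym (Occ-head o)) (trans (cong 𝐮 (sym (suc-injective (trans p+1≡ eq)))) (Occ-head oσ))

  w0-occurs : Σ ℕ λ i → Occ i (w ++ 0 ∷ [])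
  w0-occurs with τ-F-occurs
  ... | m , 𝐮m≡τ , oF , _ with starts-with-0 (F d t) [] | Φ-head k
  ...   | _ , F≡ | t₀ , Φ≡ = pos^ k m , Occ-++ w (0 ∷ []) (subst (Occ (pos^ k m)) φ^𝐮m≡w (Occ-φ^-𝐮 k m)) then-0
    where
    φ^𝐮m≡w : φ^ d k (𝐮 m ∷ []) ≡ w
    φ^𝐮m≡w = trans (cong (λ x → φ^ d k (x ∷ [])) 𝐮m≡τ) φ^-τ
    𝐮m+1≡0 : 𝐮 (suc m) ≡ 0
    𝐮m+1≡0 = Occ-head (subst (Occ (suc m)) F≡ oF)
    φ^𝐮m+1≡ : φ^ d k (𝐮 (suc m) ∷ []) ≡ 0 ∷ t₀
    φ^𝐮m+1≡ = trans (cong (λ x → φ^ d k (x ∷ [])) 𝐮m+1≡0) Φ≡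
    then-0 : Occ (pos^ k m + length w) (0 ∷ [])
    then-0 = cong (_∷ []) (begin
      𝐮 (pos^ k m + length w)                        ≡⟨ cong (λ v → 𝐮 (pos^ k m + length v)) φ^𝐮m≡w ⟨
      𝐮 (pos^ k m + length (φ^ d k (𝐮 m ∷ [])))      ≡⟨ cong 𝐮 (pos^-suc k m) ⟨
      𝐮 (pos^ k (suc m))                             ≡⟨ Occ-head (subst (Occ _) φ^𝐮m+1≡ (Occ-φ^-𝐮 k (suc m))) ⟩
      0                                              ∎)
      where open ≡-Reasoning

  exactly-two-left : ExactlyTwoLeft d w
  exactly-two-left = k , E , <-trans k<E E<d , E<d , <⇒≢ k<E ,
    map₂ Occ⇒OccursAt k∷w-occurs , map₂ Occ⇒OccursAt E∷w-occurs ,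
    λ c _ (i , o) → left-extensions (OccursAt⇒Occ {i} o)

  exactly-two-right : ExactlyTwoRight d w
  exactly-two-right = 0 , E , s≤s z≤n , E<d , 0≢1+n ,
    map₂ Occ⇒OccursAt w0-occurs ,
    map₂ (λ o → Occ⇒OccursAt (subst (Occ _) (sym w++E) o)) (F-E-E-occurs k) ,
    λ c _ (i , o) → right-of-E (F d k) c (subst (Occ i) (++-assoc (F d k) (E ∷ []) (c ∷ [])) (OccursAt⇒Occ {i} o))
    where
    w++E : w ++ E ∷ [] ≡ F d k ++ E ∷ E ∷ []
    w++E = ++-assoc (F d k) (E ∷ []) (E ∷ [])

  claims : ShortCaseClaims d k w
  claims = refl , exactly-two-left , exactly-two-right , return-word-A , return-word-B ,
    λ R rw → map ≼⇒≥P ≼⇒≥P (return-word-≽ rw)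

module LongCase (e : ℕ) where
  open FixedPoint e

  W₀ : Word
  W₀ = F d E ++ E ∷ []

  w : Word
  w = E ∷ W₀

  Φ-E : Φ E ≡ W₀
  Φ-E = φ^-letter E 0 E<d

  φ^E-starts-with-W₀ : ∀ m → Σ Word λ t → φ^ d E (𝐮 m ∷ []) ≡ W₀ ++ t
  φ^E-starts-with-W₀ m with φ^-head E (𝐮 m)
  ... | t , eq = t , trans eq (trans (cong (λ x → F d E ++ x ∷ t) (σ^-E E (𝐮 m) (𝐮<d m) (m≤n+m E (𝐮 m))))
                                    (sym (++-assoc (F d E) (E ∷ []) t)))

  Occ-W₀ : ∀ m → Occ (pos^ E m) W₀
  Occ-W₀ m with φ^E-starts-with-W₀ m
  ... | t , eq = Occ-++⁻ˡ W₀ t (subst (Occ (pos^ E m)) eq (Occ-φ^-𝐮 E m))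

  Occ-w : ∀ m → Σ ℕ λ i → suc i ≡ pos^ E (suc m) × Occ i w
  Occ-w m with letter-before-pos^ E m
  ... | i , i+1≡ , 𝐮i≡ = i , i+1≡ ,
    cong₂ _∷_ (trans 𝐮i≡ (σ^-E E (𝐮 m) (𝐮<d m) (m≤n+m E (𝐮 m)))) (subst (λ j → Occ j W₀) (sym i+1≡) (Occ-W₀ (suc m)))

  Occ-w⁻ : ∀ {i} → Occ i w → Σ ℕ λ m → pos^ E (suc m) ≡ suc i
  Occ-w⁻ o with synchronise E ≤-refl ≤-refl (Occ-tail o)
  ... | zero  , 0≡1+i = ⊥-elim (0≢1+n (trans (sym (pos^-0 E)) 0≡1+i))
  ... | suc m , eq    = m , eq

  slice-w : ∀ {i ℓ m} v → suc i ≡ pos^ E (suc m) → Occ i w → Occ (suc m) v →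
            suc ℓ ≡ pos^ E (suc m + length v) → Occ ℓ w →
            slice d i ((ℓ + length w) ∸ i) ≡ E ∷ φ^ d E v ++ W₀
  slice-w {i} {ℓ} {m} v i+1≡ oi oV ℓ+1≡ oℓ = begin
    slice d i ((ℓ + length w) ∸ i)                   ≡⟨ cong (λ n → slice d i (n ∸ i)) ℓ+w≡ ⟩
    slice d i ((i + suc L + length W₀) ∸ i)          ≡⟨ slice-factor-++ i (suc L) W₀ oW₀ ⟩
    factor i (suc L) ++ W₀                           ≡⟨ cong₂ (λ x y → x ∷ y ++ W₀) (Occ-head oi) oφ ⟩
    E ∷ φ^ d E v ++ W₀                               ∎
    where
    open ≡-Reasoning
    L : ℕ
    L = length (φ^ d E v)
    i+1+L≡ : suc i + L ≡ suc ℓ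
    i+1+L≡ = trans (cong (_+ L) i+1≡) (trans (sym (pos^-+ E oV)) (sym ℓ+1≡))
    ℓ+1≡i+L+1 : suc ℓ ≡ i + suc L
    ℓ+1≡i+L+1 = trans (sym i+1+L≡) (sym (+-suc i L))
    ℓ+w≡ : ℓ + length w ≡ i + suc L + length W₀
    ℓ+w≡ = trans (+-suc ℓ (length W₀)) (cong (_+ length W₀) ℓ+1≡i+L+1)
    oW₀ : Occ (i + suc L) W₀
    oW₀ = subst (λ j → Occ j W₀) ℓ+1≡i+L+1 (Occ-tail oℓ)
    oφ : factor (suc i) L ≡ φ^ d E v
    oφ = subst (λ j → Occ j (φ^ d E v)) (sym i+1≡) (Occ-φ^ E oV)

  return-word-≽ : ∀ {R} → IsCompleteReturnWord d w R → w ++ φ^ d E (0 ∷ []) ≼ R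
  return-word-≽ {R} (i , ℓ , i<ℓ , oi , oℓ , _ , R≡) with Occ-w⁻ {i} (OccursAt⇒Occ oi) | Occ-w⁻ {ℓ} (OccursAt⇒Occ oℓ)
  ... | m , i+1≡ | m′ , ℓ+1≡ with φ^E-starts-with-W₀ (suc m)
  ...   | t , φ^E≡ = begin
    w ++ φ^ d E (0 ∷ [])              ≡⟨ cong (λ v → E ∷ W₀ ++ v) Φ-E ⟩
    E ∷ W₀ ++ W₀                      ≲⟨ ++-mono-≼ (≼-refl {E ∷ []}) (++-mono-≼ W₀≼ (≼-refl {W₀})) ⟩
    E ∷ φ^ d E v ++ W₀                ≡⟨ slice-w v (sym i+1≡) (OccursAt⇒Occ oi) (Occ-factor (suc m) (suc n))
                                                   (trans (sym ℓ+1≡) (cong (pos^ E) m+v≡)) (OccursAt⇒Occ oℓ) ⟨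
    slice d i ((ℓ + length w) ∸ i)    ≡⟨ R≡ ⟨
    R                                 ∎
    where
    open import Relation.Binary.Reasoning.Preorder ≼-preorder
    n : ℕ
    n = m′ ∸ suc m
    v : Word
    v = factor (suc m) (suc n)
    m+1+n≡m′ : suc m + n ≡ m′
    m+1+n≡m′ = m+[n∸m]≡n (≤-pred (pos^-cancel-< E (subst₂ _<_ (sym i+1≡) (sym ℓ+1≡) (s≤s i<ℓ))))
    m+v≡ : suc m′ ≡ suc m + length v
    m+v≡ = sym (trans (cong (suc m +_) (length-factor (suc m) (suc n))) (trans (+-suc (suc m) n) (cong suc m+1+n≡m′)))
    W₀≼ : W₀ ≼ φ^ d E v
    W₀≼ = begin
      W₀                                                     ≲⟨ v≼v++w W₀ (t ++ φ^ d E (factor (suc (suc m)) n)) ⟩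
      W₀ ++ t ++ φ^ d E (factor (suc (suc m)) n)             ≡⟨ ++-assoc W₀ t _ ⟨
      (W₀ ++ t) ++ φ^ d E (factor (suc (suc m)) n)           ≡⟨ cong (_++ φ^ d E (factor (suc (suc m)) n)) φ^E≡ ⟨
      φ^ d E (𝐮 (suc m) ∷ []) ++ φ^ d E (factor (suc (suc m)) n) ≡⟨ φ^-∷ d E (𝐮 (suc m)) _ ⟨
      φ^ d E v                                               ∎

  𝐮-0 : 𝐮 0 ≡ 0
  𝐮-0 = subst (λ j → 𝐮 j ≡ 0) pos-0 (𝐮-pos 0)

  𝐮-1 : 𝐮 1 ≡ 1
  𝐮-1 = trans (cong (λ j → 𝐮 (j + 1)) (sym pos-0))
              (trans (𝐮-pos+1-short 0 (subst (λ x → suc x < d) (sym 𝐮-0) (s≤s (s≤s z≤n)))) (cong suc 𝐮-0))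

  𝐮-2 : 𝐮 2 ≡ 0
  𝐮-2 = subst (λ j → 𝐮 j ≡ 0) pos-1 (𝐮-pos 1)
    where
    pos-1 : pos 1 ≡ 2
    pos-1 = trans (pos-suc 0 (trans (cong (φ₁ d) 𝐮-0) φ₁-0)) (cong (_+ 2) pos-0)

  return-word-B : IsCompleteReturnWord d w (w ++ φ^ d E (0 ∷ []))
  return-word-B with Occ-w 1 | Occ-w 2
  ... | i , i+1≡ , oi | ℓ , ℓ+1≡ , oℓ =
    i , ℓ , ≤-pred (subst₂ _<_ (sym i+1≡) (sym ℓ+1≡) (pos^-<-suc E 2)) , Occ⇒OccursAt oi , Occ⇒OccursAt oℓ ,
    no-w-between , sym (trans (slice-w (𝐮 2 ∷ []) i+1≡ oi refl ℓ+1≡ oℓ) R≡)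
    where
    R≡ : E ∷ φ^ d E (𝐮 2 ∷ []) ++ W₀ ≡ w ++ φ^ d E (0 ∷ [])
    R≡ = cong (E ∷_) (trans (cong (λ x → φ^ d E (x ∷ []) ++ W₀) 𝐮-2) (trans (cong (_++ W₀) Φ-E) (cong (W₀ ++_) (sym Φ-E))))
    no-w-between : ∀ j → i < j → j < ℓ → ¬ OccursAt d w j
    no-w-between j i<j j<ℓ oj with Occ-w⁻ {j} (OccursAt⇒Occ oj)
    ... | m , j+1≡ = <⇒≱ (pos^-cancel-< E (subst₂ _<_ (sym j+1≡) ℓ+1≡ (s≤s j<ℓ)))
                         (pos^-cancel-< E (subst₂ _<_ i+1≡ (sym j+1≡) (s≤s i<j)))

  c∷w-occurs : ∀ m {c v} → φ^ d E (𝐮 m ∷ []) ≡ v ++ c ∷ E ∷ [] → Σ ℕ λ i → Occ i (c ∷ w)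
  c∷w-occurs m {c} {v} eq = pos^ E m + length v , Occ-++ (c ∷ E ∷ []) W₀ (Occ-++⁻ʳ v _ image) oW₀
    where
    image : Occ (pos^ E m) (v ++ c ∷ E ∷ [])
    image = subst (Occ (pos^ E m)) eq (Occ-φ^-𝐮 E m)
    next : pos^ E (suc m) ≡ pos^ E m + length v + 2
    next = trans (pos^-suc E m) (trans (cong (λ x → pos^ E m + length x) eq)
                 (trans (cong (pos^ E m +_) (length-++ v)) (sym (+-assoc (pos^ E m) (length v) 2))))
    oW₀ : Occ (pos^ E m + length v + 2) W₀
    oW₀ = subst (λ j → Occ j W₀) next (Occ-W₀ (suc m))

  φ^E-1 : φ^ d E (1 ∷ []) ≡ φ d (F d (suc e)) ++ 0 ∷ E ∷ E ∷ []
  φ^E-1 = trans (cong (φ d) (φ^-letter (suc e) 1 E<d))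
                (trans (φ-++ d (F d (suc e)) (E ∷ [])) (cong (λ v → φ d (F d (suc e)) ++ v ++ []) φ₁-E))

  exactly-two-left : ExactlyTwoLeft d w
  exactly-two-left = 0 , E , s≤s z≤n , E<d , 0≢1+n ,
    map₂ Occ⇒OccursAt (c∷w-occurs 0 (trans (cong (λ x → φ^ d E (x ∷ [])) 𝐮-0) (trans Φ-E (++-assoc φF (0 ∷ []) (E ∷ []))))) ,
    map₂ Occ⇒OccursAt (c∷w-occurs 1 (trans (cong (λ x → φ^ d E (x ∷ [])) 𝐮-1) (trans φ^E-1 (sym (++-assoc φF (0 ∷ []) _))))) ,
    λ c _ (i , o) → subst (λ x → x ≡ 0 ⊎ x ≡ E) (Occ-head (OccursAt⇒Occ {i} o))
      (before-nonzero i λ 𝐮≡0 → 0≢1+n (trans (sym 𝐮≡0) (Occ-head (Occ-tail (OccursAt⇒Occ {i} o)))))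
    where
    φF : Word
    φF = φ d (F d (suc e))

  w-then : ∀ m c → Occ (pos^ E (suc m)) (W₀ ++ c ∷ []) → Σ ℕ λ i → Occ i (w ++ c ∷ [])
  w-then m c o with Occ-w m
  ... | i , i+1≡ , oi = i , cong₂ _∷_ (Occ-head oi) (subst (λ j → Occ j (W₀ ++ c ∷ [])) (sym i+1≡) o)

  exactly-two-right : ExactlyTwoRight d w
  exactly-two-right = 0 , E , s≤s z≤n , E<d , 0≢1+n ,
    map₂ Occ⇒OccursAt (w-then 1 0 (Occ-++ W₀ (0 ∷ []) (Occ-W₀ 2) then-0)) ,
    map₂ Occ⇒OccursAt (w-then 0 E (subst (Occ (pos^ E 1)) W₀E (Occ-φ^-𝐮 E 1))) ,
    λ c _ (i , o) → right-of-E (E ∷ F d E) c (subst (Occ i) (++-assoc (E ∷ F d E) (E ∷ []) (c ∷ [])) (OccursAt⇒Occ {i} o))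
    where
    pos^-3 : pos^ E 3 ≡ pos^ E 2 + length W₀
    pos^-3 = trans (pos^-suc E 2) (cong (λ v → pos^ E 2 + length v) (trans (cong (λ x → φ^ d E (x ∷ [])) 𝐮-2) Φ-E))
    then-0 : Occ (pos^ E 2 + length W₀) (0 ∷ [])
    then-0 = cong (_∷ []) (subst (λ j → 𝐮 j ≡ 0) pos^-3 (𝐮-pos _))
    W₀E : φ^ d E (𝐮 1 ∷ []) ≡ W₀ ++ E ∷ []
    W₀E = trans (cong (λ x → φ^ d E (x ∷ [])) 𝐮-1) (trans φ^E-1
            (sym (trans (++-assoc (F d E) (E ∷ []) (E ∷ [])) (++-assoc (φ d (F d (suc e))) (0 ∷ []) (E ∷ E ∷ [])))))

  claims : LongCaseClaims d w
  claims = refl , exactly-two-left , exactly-two-right , return-word-B , λ R rw → ≼⇒≥P (return-word-≽ rw)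

module BispecialFactors (e : ℕ) where
  open FixedPoint e using (d; E)

  f-short : ∀ a v b → a ≢ suc e → b ≢ suc e → f d (a , v , b) ≡ (incMod E a , φ d v ++ 0 ∷ [] , incMod E b)
  f-short a v b a≢ b≢ with a ≟ suc e | b ≟ suc e
  ... | yes a≡ | _      = ⊥-elim (a≢ a≡)
  ... | no _   | yes b≡ = ⊥-elim (b≢ b≡)
  ... | no _   | no _   = refl

  bisp-f-right : ∀ a v → a ≢ suc e → bisp (f d (a , v , suc e)) ≡ φ d v ++ 0 ∷ E ∷ []
  bisp-f-right a v a≢ with a ≟ suc e | suc e ≟ suc e
  ... | yes a≡ | _     = ⊥-elim (a≢ a≡)
  ... | no _   | yes _ = refl
  ... | no _   | no ≢  = ⊥-elim (≢ refl)

  bisp-f-both : ∀ v → bisp (f d (suc e , v , suc e)) ≡ E ∷ φ d v ++ 0 ∷ E ∷ []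
  bisp-f-both v with suc e ≟ suc e
  ... | yes _ = refl
  ... | no ≢  = ⊥-elim (≢ refl)

  T-E : T d E ≡ (0 , E ∷ [] , 0)
  T-E with E ≟ E
  ... | yes _ = refl
  ... | no ≢  = ⊥-elim (≢ refl)

  T-< : ∀ b → b < E → T d b ≡ (0 , [] , b)
  T-< b b<E with b ≟ E
  ... | yes b≡E = ⊥-elim (<-irrefl b≡E b<E)
  ... | no _    = refl

  f^-T : ∀ j b → b + j < E → f^ d j (0 , [] , b) ≡ (j , F d j , b + j)
  f^-T zero    b _   = cong (λ x → 0 , [] , x) (sym (+-identityʳ b))
  f^-T (suc j) b b+j+1<E = begin
    f d (f^ d j (0 , [] , b))                         ≡⟨ cong (f d) (f^-T j b (<-trans (n<1+n _) 1+b+j<E)) ⟩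
    f d (j , F d j , b + j)                           ≡⟨ f-short j (F d j) (b + j) (<⇒≢ j<1+e) (<⇒≢ b+j<1+e) ⟩
    (incMod E j , F d (suc j) , incMod E (b + j))     ≡⟨ cong₂ (λ x y → x , F d (suc j) , y) (m<n⇒m%n≡m j+1<E) (m<n⇒m%n≡m 1+b+j<E) ⟩
    (suc j , F d (suc j) , suc (b + j))               ≡⟨ cong (λ x → suc j , F d (suc j) , x) (+-suc b j) ⟨
    (suc j , F d (suc j) , b + suc j)                 ∎
    where
    open ≡-Reasoning
    1+b+j<E : suc (b + j) < E
    1+b+j<E = subst (_< E) (+-suc b j) b+j+1<E
    b+j<1+e : b + j < suc e
    b+j<1+e = ≤-pred 1+b+j<E
    j+1<E : suc j < E
    j+1<E = ≤-<-trans (s≤s (m≤n+m j b)) 1+b+j<E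
    j<1+e : j < suc e
    j<1+e = ≤-pred j+1<E

  bisp-short : ∀ k → k < E → bisp (f^ d k (T d (E ∸ k))) ≡ F d k ++ E ∷ []
  bisp-short zero    _       = cong bisp T-E
  bisp-short (suc k) k+1<E = begin
    bisp (f d (f^ d k (T d (suc e ∸ k))))          ≡⟨ cong (λ t → bisp (f d (f^ d k t))) (T-< (suc e ∸ k) (s≤s (m∸n≤m (suc e) k))) ⟩
    bisp (f d (f^ d k (0 , [] , suc e ∸ k)))       ≡⟨ cong (bisp ∘ f d) (f^-T k (suc e ∸ k) (subst (_< E) (sym b≡) ≤-refl)) ⟩
    bisp (f d (k , F d k , suc e ∸ k + k))         ≡⟨ cong (λ b → bisp (f d (k , F d k , b))) b≡ ⟩
    bisp (f d (k , F d k , suc e))                 ≡⟨ bisp-f-right k (F d k) (<⇒≢ (≤-pred k+1<E)) ⟩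
    φ d (F d k) ++ 0 ∷ E ∷ []                      ≡⟨ ++-assoc (φ d (F d k)) (0 ∷ []) (E ∷ []) ⟨
    F d (suc k) ++ E ∷ []                          ∎
    where
    open ≡-Reasoning
    b≡ : suc e ∸ k + k ≡ suc e
    b≡ = m∸n+n≡m (<⇒≤ (≤-pred k+1<E))

  bisp-long : bisp (f^ d E (T d (E ∸ E))) ≡ E ∷ F d E ++ E ∷ []
  bisp-long = begin
    bisp (f d (f^ d (suc e) (T d (E ∸ E))))        ≡⟨ cong (λ b → bisp (f d (f^ d (suc e) (T d b)))) (n∸n≡0 E) ⟩
    bisp (f d (f^ d (suc e) (T d 0)))              ≡⟨ cong (λ t → bisp (f d (f^ d (suc e) t))) (T-< 0 (s≤s z≤n)) ⟩
    bisp (f d (f^ d (suc e) (0 , [] , 0)))         ≡⟨ cong (bisp ∘ f d) (f^-T (suc e) 0 ≤-refl) ⟩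
    bisp (f d (suc e , F d (suc e) , suc e))       ≡⟨ bisp-f-both (F d (suc e)) ⟩
    E ∷ φ d (F d (suc e)) ++ 0 ∷ E ∷ []            ≡⟨ cong (E ∷_) (++-assoc (φ d (F d (suc e))) (0 ∷ []) (E ∷ [])) ⟨
    E ∷ F d E ++ E ∷ []                            ∎
    where open ≡-Reasoning

proposition18 : (d : ℕ) → 3 ≤ d → (k : ℕ) → k < d →
    (k ≡ d ∸ 1 →
      bisp (f^ d k (T d (d ∸ 1 ∸ k))) ≡ (d ∸ 1) ∷ F d (d ∸ 1) ++ (d ∸ 1) ∷ []
      × ExactlyTwoLeft d (bisp (f^ d k (T d (d ∸ 1 ∸ k))))
      × ExactlyTwoRight d (bisp (f^ d k (T d (d ∸ 1 ∸ k))))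
      × IsCompleteReturnWord d (bisp (f^ d k (T d (d ∸ 1 ∸ k))))
          (bisp (f^ d k (T d (d ∸ 1 ∸ k))) ++ φ^ d (d ∸ 1) (0 ∷ []))
      × (∀ R → IsCompleteReturnWord d (bisp (f^ d k (T d (d ∸ 1 ∸ k)))) R →
           parikh d R ≥P parikh d (bisp (f^ d k (T d (d ∸ 1 ∸ k))) ++ φ^ d (d ∸ 1) (0 ∷ []))))
    × (k < d ∸ 1 →
      bisp (f^ d k (T d (d ∸ 1 ∸ k))) ≡ F d k ++ (d ∸ 1) ∷ []
      × ExactlyTwoLeft d (bisp (f^ d k (T d (d ∸ 1 ∸ k))))
      × ExactlyTwoRight d (bisp (f^ d k (T d (d ∸ 1 ∸ k))))
      × IsCompleteReturnWord d (bisp (f^ d k (T d (d ∸ 1 ∸ k))))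
          (φ^ d k ((d ∸ 1) ∷ []) ++ bisp (f^ d k (T d (d ∸ 1 ∸ k))))
      × IsCompleteReturnWord d (bisp (f^ d k (T d (d ∸ 1 ∸ k))))
          (bisp (f^ d k (T d (d ∸ 1 ∸ k))) ++ φ^ d (d ∸ 1) (0 ∷ []))
      × (∀ R → IsCompleteReturnWord d (bisp (f^ d k (T d (d ∸ 1 ∸ k)))) R →
           parikh d R ≥P parikh d (φ^ d k ((d ∸ 1) ∷ []) ++ bisp (f^ d k (T d (d ∸ 1 ∸ k))))
           ⊎ parikh d R ≥P parikh d (bisp (f^ d k (T d (d ∸ 1 ∸ k))) ++ φ^ d (d ∸ 1) (0 ∷ []))))
proposition18 (suc zero)          (s≤s ())       _ _
proposition18 (suc (suc zero))    (s≤s (s≤s ())) _ _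
proposition18 (suc (suc (suc e))) _ k _ = long-case , short-case
  where
  open FixedPoint e using (d; E)
  w : Word
  w = bisp (f^ d k (T d (E ∸ k)))

  long-case : k ≡ E → LongCaseClaims d w
  long-case refl = subst (LongCaseClaims d) (sym (BispecialFactors.bisp-long e)) (LongCase.claims e)

  short-case : k < E → ShortCaseClaims d k w
  short-case k<E = subst (ShortCaseClaims d k) (sym (BispecialFactors.bisp-short e k k<E)) (ShortCase.claims e k t k+τ≡E)
    where
    t : ℕ
    t = suc e ∸ k
    k+τ≡E : k + suc t ≡ E
    k+τ≡E = trans (+-suc k t) (cong suc (m+[n∸m]≡n (≤-pred k<E)))
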